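{- Let $G$ be a (finite, simple, undirected) graph of order $n$ with stability number $\alpha$ (so $1\le \alpha\le n$). Then \[F(G)\le f_{\sf T}(n,\alpha)=\left(\left\lceil\tfrac{n}{\alpha}\right\rceil+1\right)^{p}\left(\left\lfloor\tfrac{n}{\alpha}\right\rfloor+1\right)^{\alpha-p},\qquad p=n \bmod \alpha,\] with equality if and only if $G\simeq T_{n,\alpha}$.
   Context: A stable set of a graph is a set of pairwise non-adjacent vertices. The stability number $\alpha(G)$ is the maximum size of a stable set. The Fibonacci index $F(G)$ is the number of stable sets of $G$, including the empty set. For $1\le\alpha\le n$, the Turán graph $T_{n,\alpha}$ is the disjoint union of $\alpha$ cliques whose orders sum to $n$ and differ pairwise by at most one (so each has $\lceil n/\alpha\rceil$ or $\lfloor n/\alpha\rfloor$ vertices); it is unique up to isomorphism, and $f_{\sf T}(n,\alpha)$ denotes $F(T_{n,\alpha})$. -}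

module Defs where

open import Data.Nat using (ℕ; zero; suc; _+_; _∸_; _/_; _%_; _≤_; NonZero)
open import Data.Nat.Properties using () renaming (_≟_ to _≟ℕ_)
open import Data.Bool using (Bool; true; false; _∧_; not)
open import Data.Fin using (Fin; toℕ)
open import Data.Fin.Properties using (all?)
open import Data.Fin.Subset using (Subset; _∈_; ∣_∣; inside; outside)
open import Data.Fin.Subset.Properties using (_∈?_)
open import Data.Vec using (Vec; []; _∷_)
open import Data.List using (List; []; _∷_; map; _++_; length; filter)
open import Data.Empty using (⊥-elim)
open import Data.Product using (Σ; _×_; ∃)
open import Function.Bundles using (_↔_; Inverse)
open import Relation.Binary.PropositionalEquality using (_≡_; refl) renaming (sym to ≡-sym)
open import Relation.Nullary using (Dec; yes; no; ¬_)
open import Relation.Nullary.Decidable using (_→-dec_)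
open import Data.Bool.Properties using () renaming (_≟_ to _≟B_)

record Graph (n : ℕ) : Set where
  field
    adj    : Fin n → Fin n → Bool
    sym    : ∀ i j → adj i j ≡ adj j i
    irrefl : ∀ i → adj i i ≡ false
open Graph public

Stable : ∀ {n} → Graph n → Subset n → Set
Stable G S = ∀ i j → i ∈ S → j ∈ S → adj G i j ≡ false

stable? : ∀ {n} (G : Graph n) (S : Subset n) → Dec (Stable G S)
stable? G S = all? λ i → all? λ j →
  (i ∈? S) →-dec ((j ∈? S) →-dec (adj G i j ≟B false))

allSubsets : (n : ℕ) → List (Subset n)
allSubsets zero = [] ∷ []
allSubsets (suc n) = map (inside ∷_) (allSubsets n) ++ map (outside ∷_) (allSubsets n)

-- Fibonacci index: number of stable sets (including the empty set).
F : ∀ {n} → Graph n → ℕ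
F {n} G = length (filter (stable? G) (allSubsets n))

HasStabilityNumber : ∀ {n} → Graph n → ℕ → Set
HasStabilityNumber G α =
  (Σ _ λ S → Stable G S × ∣ S ∣ ≡ α) × (∀ S → Stable G S → ∣ S ∣ ≤ α)

_≃G_ : ∀ {n} → Graph n → Graph n → Set
_≃G_ {n} G H = Σ (Fin n ↔ Fin n) λ φ →
  ∀ i j → adj H (Inverse.to φ i) (Inverse.to φ j) ≡ adj G i j

-- Turán graph T_{n,α}: vertex i lies in clique number (i mod α); two distinct
-- vertices are adjacent iff they lie in the same clique. The α cliques have
-- orders ⌊n/α⌋+1 (for the first n mod α of them) or ⌊n/α⌋, so they differ
-- pairwise by at most one.
turanAdj : ∀ {n} (α : ℕ) .{{_ : NonZero α}} → Fin n → Fin n → Bool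
turanAdj α i j with toℕ i ≟ℕ toℕ j
... | yes _ = false
... | no _ with (toℕ i % α) ≟ℕ (toℕ j % α)
...   | yes _ = true
...   | no _ = false

turanAdj-irrefl : ∀ {n} (α : ℕ) .{{_ : NonZero α}} (i : Fin n) → turanAdj α i i ≡ false
turanAdj-irrefl α i with toℕ i ≟ℕ toℕ i
... | yes _ = refl
... | no ¬p = ⊥-elim (¬p refl)

turanAdj-sym : ∀ {n} (α : ℕ) .{{_ : NonZero α}} (i j : Fin n) → turanAdj α i j ≡ turanAdj α j i
turanAdj-sym α i j with toℕ i ≟ℕ toℕ j | toℕ j ≟ℕ toℕ i
... | yes _ | yes _ = refl
... | yes p | no ¬q = ⊥-elim (¬q (≡-sym p))
... | no ¬p | yes q = ⊥-elim (¬p (≡-sym q))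
... | no _ | no _ with (toℕ i % α) ≟ℕ (toℕ j % α) | (toℕ j % α) ≟ℕ (toℕ i % α)
...   | yes _ | yes _ = refl
...   | yes p | no ¬q = ⊥-elim (¬q (≡-sym p))
...   | no ¬p | yes q = ⊥-elim (¬p (≡-sym q))
...   | no _ | no _ = refl

Turan : (n α : ℕ) .{{_ : NonZero α}} → Graph n
Turan n α = record { adj = turanAdj α ; sym = turanAdj-sym α ; irrefl = turanAdj-irrefl α }

fT : (n α : ℕ) .{{_ : NonZero α}} → ℕ
fT n α = F (Turan n α)

⌈_/_⌉ : (n α : ℕ) .{{_ : NonZero α}} → ℕ
⌈ n / α ⌉ = (n + (α ∸ 1)) / α

module Submission where

-- For a vertex set U let ι U count the stable sets of G[U]; deleting a vertex v gives
-- ι U = ι(U − v) + ι(U − N[v]).  The value τ m a = f_T(m, a) obeys the matching recurrence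
-- τ(m+1, a) = τ(m, a) + τ(m+1 − ⌈(m+1)/a⌉, a − 1).  If α(G[U]) ≤ a, a greedy stable set shows that
-- some v has |N[v]| ≥ ⌈|U|/a⌉, while α(G[U − N[v]]) ≤ a − 1; strong induction on |U| gives
-- ι U ≤ τ(|U|, a).  In the equality case both inductive bounds are tight: G[U − v] is a balanced
-- disjoint union of cliques, |N[v]| = ⌈|U|/a⌉, and v is joined to exactly one small clique, so G[U]
-- is balanced too.  Disjoint unions of cliques are given by vertex labellings; their index is
-- ∏ (1 + clique order), which is τ for balanced labellings such as the residues mod α labelling
-- T_{n,α}.  Balanced labellings with the same parameters differ by a vertex permutation.

open import Data.Nat using (ℕ; zero; suc; _+_; _*_; _∸_; _^_; _/_; _%_; _≤_; _<_; z≤n; s≤s; _≡ᵇ_; _<ᵇ_; _<?_; NonZero)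
open import Data.Nat.Properties
open import Data.Nat.DivMod
open import Data.Nat.Induction using (<-rec)
open import Data.Nat.ListAction using (sum)
open import Data.Nat.ListAction.Properties using (sum-++)
open import Algebra.Properties.CommutativeSemigroup +-commutativeSemigroup
  using () renaming (x∙yz≈y∙xz to +-swap; interchange to +-interchange)
open import Algebra.Properties.CommutativeSemigroup *-commutativeSemigroup using () renaming (x∙yz≈y∙xz to *-swap)
open import Data.Nat.Solver using (module +-*-Solver)
open +-*-Solver using (solve; _:+_; _:*_; _:=_; con)
open import Data.Bool using (Bool; true; false; _∧_; _∨_; not; if_then_else_)
open import Data.Bool.Properties using (T-≡; ∧-assoc; ∧-comm; ∧-zeroʳ; ∧-identityʳ)
import Data.Bool.Properties as Bool
open import Data.Fin using (Fin; zero; suc; toℕ; punchIn)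
import Data.Fin.Properties as Fin
open import Data.Fin.Permutation using (Permutation′; _⟨$⟩ʳ_; _⟨$⟩ˡ_; insert; insert-punchIn; inverseˡ; remove; punchIn-permute)
import Data.Fin.Permutation as Permutation
open import Data.Fin.Subset using (Subset; ∣_∣) renaming (⊥ to ∅)
open import Data.Fin.Subset.Properties using (∣⊥∣≡0)
open import Data.Vec using ([]; _∷_; lookup; _[_]≔_)
open import Data.Vec.Properties using (lookup∘update; lookup∘update′; lookup-replicate; lookup⇒[]=; []=⇒lookup)
open import Data.List using ([]; _∷_; map; _++_; length; filter)
open import Data.List.Properties using (map-++; map-∘)
open import Data.Product using (Σ; _×_; _,_; proj₁; proj₂)
open import Data.Sum using (_⊎_; inj₁; inj₂)
open import Data.Empty using (⊥; ⊥-elim)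
open import Function using (_∘_; Equivalence; Inverse)
open import Function.Bundles using (_⇔_; mk⇔)
open import Relation.Binary.PropositionalEquality
open import Relation.Binary.Definitions using (tri<; tri≈; tri>)
open import Relation.Nullary using (Dec; yes; no; ¬_; does)
open import Relation.Nullary.Decidable using (dec-true; dec-false; _×-dec_; _→-dec_; T?)
open import Defs renaming (sym to adj-sym)

𝟙 : Bool → ℕ
𝟙 true = 1
𝟙 false = 0

true≢false : ∀ {a} → a ≡ true → a ≡ false → ⊥
true≢false refl ()

true-or-false : ∀ a → a ≡ true ⊎ a ≡ false
true-or-false true = inj₁ refl
true-or-false false = inj₂ refl

∧-intro : ∀ {a b} → a ≡ true → b ≡ true → a ∧ b ≡ true
∧-intro refl refl = refl

∧-elimˡ : ∀ a {b} → a ∧ b ≡ true → a ≡ true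
∧-elimˡ true _ = refl

∧-elimʳ : ∀ a {b} → a ∧ b ≡ true → b ≡ true
∧-elimʳ true p = p

bool-ext : ∀ a b → (a ≡ true → b ≡ true) → (b ≡ true → a ≡ true) → a ≡ b
bool-ext true true _ _ = refl
bool-ext true false f _ = sym (f refl)
bool-ext false true _ g = g refl
bool-ext false false _ _ = refl

𝟙-does-cong : ∀ {P Q : Set} (p : Dec P) (q : Dec Q) → (P → Q) → (Q → P) → 𝟙 (does p) ≡ 𝟙 (does q)
𝟙-does-cong p q f g = cong 𝟙 (bool-ext _ _ (λ e → dec-true q (f (witness p e))) (λ e → dec-true p (g (witness q e))))
  where
  witness : ∀ {R : Set} (r : Dec R) → does r ≡ true → R
  witness (yes x) _ = x

_==_ : ∀ {n} → Fin n → Fin n → Bool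
i == j = does (i Fin.≟ j)

==-refl : ∀ {n} (i : Fin n) → (i == i) ≡ true
==-refl i = dec-true (i Fin.≟ i) refl

==-false : ∀ {n} {i j : Fin n} → i ≢ j → (i == j) ≡ false
==-false {i = i} {j} = dec-false (i Fin.≟ j)

==-sound : ∀ {n} {i j : Fin n} → (i == j) ≡ true → i ≡ j
==-sound {i = i} {j} e with i Fin.≟ j
... | yes p = p

==-sym : ∀ {n} (i j : Fin n) → (i == j) ≡ (j == i)
==-sym i j = bool-ext _ _ (λ e → subst (λ x → (x == i) ≡ true) (==-sound {i = i} {j} e) (==-refl i))
                          (λ e → subst (λ x → (x == j) ≡ true) (==-sound {i = j} {i} e) (==-refl j))

≡ᵇ-true : ∀ {m n} → m ≡ n → (m ≡ᵇ n) ≡ true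
≡ᵇ-true {m} {n} p = Equivalence.to T-≡ (≡⇒≡ᵇ m n p)

≡ᵇ-refl : ∀ m → (m ≡ᵇ m) ≡ true
≡ᵇ-refl m = ≡ᵇ-true {m} refl

≡ᵇ-sound : ∀ {m n} → (m ≡ᵇ n) ≡ true → m ≡ n
≡ᵇ-sound {m} {n} e = ≡ᵇ⇒≡ m n (Equivalence.from T-≡ e)

≡ᵇ-false : ∀ {m n} → m ≢ n → (m ≡ᵇ n) ≡ false
≡ᵇ-false {m} {n} ne with true-or-false (m ≡ᵇ n)
... | inj₁ e = ⊥-elim (ne (≡ᵇ-sound e))
... | inj₂ e = e

≡ᵇ-sym : ∀ m n → (m ≡ᵇ n) ≡ (n ≡ᵇ m)
≡ᵇ-sym m n = bool-ext _ _ (λ e → ≡ᵇ-true (sym (≡ᵇ-sound {m} {n} e))) (λ e → ≡ᵇ-true (sym (≡ᵇ-sound {n} {m} e)))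

<ᵇ-true : ∀ {m n} → m < n → (m <ᵇ n) ≡ true
<ᵇ-true {m} {n} lt = Equivalence.to T-≡ (<⇒<ᵇ lt)

<ᵇ-false : ∀ {m n} → ¬ (m < n) → (m <ᵇ n) ≡ false
<ᵇ-false {m} {n} nlt with true-or-false (m <ᵇ n)
... | inj₁ e = ⊥-elim (nlt (<ᵇ⇒< m n (Equivalence.from T-≡ e)))
... | inj₂ e = e

count : ∀ {n} → (Fin n → Bool) → ℕ
count {zero} _ = 0
count {suc n} P = 𝟙 (P zero) + count (P ∘ suc)

_─_ : ∀ {n} → (Fin n → Bool) → Fin n → Fin n → Bool
(P ─ v) i = P i ∧ not (i == v)

─-spec : ∀ {n} (P : Fin n → Bool) v i → (P ─ v) i ≡ true → P i ≡ true × i ≢ v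
─-spec P v i e with i Fin.≟ v
... | yes _ = ⊥-elim (true≢false e (∧-zeroʳ (P i)))
... | no i≢v = trans (sym (∧-identityʳ (P i))) e , i≢v

─-intro : ∀ {n} (P : Fin n → Bool) v i → P i ≡ true → i ≢ v → (P ─ v) i ≡ true
─-intro P v i Pi i≢v rewrite Pi | ==-false i≢v = refl

count-cong : ∀ {n} {P Q : Fin n → Bool} → (∀ i → P i ≡ Q i) → count P ≡ count Q
count-cong {zero} e = refl
count-cong {suc n} e = cong₂ _+_ (cong 𝟙 (e zero)) (count-cong (e ∘ suc))

count-none : ∀ {n} (P : Fin n → Bool) → (∀ i → P i ≡ false) → count P ≡ 0
count-none {zero} P e = refl
count-none {suc n} P e rewrite e zero = count-none (P ∘ suc) (e ∘ suc)

none-or-witness : ∀ {n} (P : Fin n → Bool) → (∀ i → P i ≡ false) ⊎ Σ (Fin n) (λ v → P v ≡ true)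
none-or-witness {zero} P = inj₁ (λ ())
none-or-witness {suc n} P with P zero in P0 | none-or-witness (P ∘ suc)
... | true | _ = inj₂ (zero , P0)
... | false | inj₁ none = inj₁ λ { zero → P0 ; (suc i) → none i }
... | false | inj₂ (v , Pv) = inj₂ (suc v , Pv)

count-split : ∀ {n} (P Q : Fin n → Bool) → count P ≡ count (λ i → P i ∧ Q i) + count (λ i → P i ∧ not (Q i))
count-split {zero} P Q = refl
count-split {suc n} P Q rewrite count-split (P ∘ suc) (Q ∘ suc) with P zero | Q zero
... | true | true = refl
... | true | false = sym (+-suc _ _)
... | false | _ = refl

count-mono : ∀ {n} (P Q : Fin n → Bool) → (∀ i → P i ≡ true → Q i ≡ true) → count P ≤ count Q
count-mono {zero} P Q h = z≤n
count-mono {suc n} P Q h with P zero in P0 | Q zero in Q0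
... | true | true = s≤s (count-mono (P ∘ suc) (Q ∘ suc) (h ∘ suc))
... | true | false = ⊥-elim (true≢false (h zero P0) Q0)
... | false | true = m≤n⇒m≤1+n (count-mono (P ∘ suc) (Q ∘ suc) (h ∘ suc))
... | false | false = count-mono (P ∘ suc) (Q ∘ suc) (h ∘ suc)

count-remove : ∀ {n} (P : Fin n → Bool) v → count P ≡ 𝟙 (P v) + count (P ─ v)
count-remove {suc n} P zero with P zero
... | true = cong suc (count-cong (λ i → sym (∧-identityʳ (P (suc i)))))
... | false = count-cong (λ i → sym (∧-identityʳ (P (suc i))))
count-remove {suc n} P (suc v) = begin
    𝟙 (P zero) + count (P ∘ suc)
  ≡⟨ cong (𝟙 (P zero) +_) (count-remove (P ∘ suc) v) ⟩
    𝟙 (P zero) + (𝟙 (P (suc v)) + count ((P ∘ suc) ─ v))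
  ≡⟨ +-swap (𝟙 (P zero)) (𝟙 (P (suc v))) (count ((P ∘ suc) ─ v)) ⟩
    𝟙 (P (suc v)) + (𝟙 (P zero) + count ((P ∘ suc) ─ v))
  ≡⟨ cong (λ b → 𝟙 (P (suc v)) + (𝟙 b + count ((P ∘ suc) ─ v))) (sym (∧-identityʳ (P zero))) ⟩
    𝟙 (P (suc v)) + count (P ─ suc v) ∎
  where open ≡-Reasoning

count-remove-member : ∀ {n} (P : Fin n → Bool) v → P v ≡ true → count P ≡ suc (count (P ─ v))
count-remove-member P v Pv = trans (count-remove P v) (cong (λ b → 𝟙 b + count (P ─ v)) Pv)

count-─-< : ∀ {n} (P : Fin n → Bool) v → P v ≡ true → count (P ─ v) < count P
count-─-< P v Pv = ≤-reflexive (sym (count-remove-member P v Pv))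

count-─-≡ : ∀ {n} (P : Fin n → Bool) v {m} → count P ≡ suc m → P v ≡ true → count (P ─ v) ≡ m
count-─-≡ P v |P| Pv = suc-injective (trans (sym (count-remove-member P v Pv)) |P|)

count-pos : ∀ {n} (P : Fin n → Bool) v → P v ≡ true → 1 ≤ count P
count-pos P v Pv rewrite count-remove-member P v Pv = s≤s z≤n

count-witness : ∀ {n} (P : Fin n → Bool) → 1 ≤ count P → Σ (Fin n) λ v → P v ≡ true
count-witness {suc n} P h with P zero in P0
... | true = zero , P0
... | false with count-witness (P ∘ suc) h
... | v , Pv = suc v , Pv

count-⊆-≥⇒⊇ : ∀ {n} (P Q : Fin n → Bool) → (∀ i → P i ≡ true → Q i ≡ true) → count Q ≤ count P →
              ∀ i → Q i ≡ true → P i ≡ true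
count-⊆-≥⇒⊇ P Q P⊆Q Q≤P i Qi with true-or-false (P i)
... | inj₁ Pi = Pi
... | inj₂ Pi = ⊥-elim (<-irrefl refl (<-≤-trans P<Q Q≤P))
  where
  QP Q¬P : ℕ
  QP = count (λ j → Q j ∧ P j)
  Q¬P = count (λ j → Q j ∧ not (P j))
  P≤QP : count P ≤ QP
  P≤QP = count-mono P _ (λ j Pj → ∧-intro (P⊆Q j Pj) Pj)
  P<Q : count P < count Q
  P<Q = begin-strict
      count P
    ≤⟨ P≤QP ⟩
      QP
    <⟨ m<m+n QP (count-pos _ i (∧-intro Qi (cong not Pi))) ⟩
      QP + Q¬P
    ≡⟨ sym (count-split Q P) ⟩
      count Q ∎
    where open ≤-Reasoning

count-induction : ∀ {n} (P : (Fin n → Bool) → Set) →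
                  (∀ U → (∀ V → count V < count U → P V) → P U) → ∀ U → P U
count-induction {n} P step U = <-rec (λ m → ∀ U → count U ≡ m → P U)
  (λ { _ ih U refl → step U (λ V V<U → ih V<U V refl) }) (count U) U refl

count-punchIn : ∀ {n} (P : Fin (suc n) → Bool) j → count P ≡ 𝟙 (P j) + count (P ∘ punchIn j)
count-punchIn P zero = refl
count-punchIn {suc n} P (suc j) = begin
    𝟙 (P zero) + count (P ∘ suc)
  ≡⟨ cong (𝟙 (P zero) +_) (count-punchIn (P ∘ suc) j) ⟩
    𝟙 (P zero) + (𝟙 (P (suc j)) + count (P ∘ suc ∘ punchIn j))
  ≡⟨ +-swap (𝟙 (P zero)) (𝟙 (P (suc j))) (count (P ∘ suc ∘ punchIn j)) ⟩
    𝟙 (P (suc j)) + count (P ∘ punchIn (suc j)) ∎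
  where open ≡-Reasoning

count-permute : ∀ {n} (φ : Permutation′ n) (P : Fin n → Bool) → count (λ i → P (φ ⟨$⟩ʳ i)) ≡ count P
count-permute {zero} φ P = refl
count-permute {suc n} φ P = begin
    𝟙 (P (φ ⟨$⟩ʳ zero)) + count (λ i → P (φ ⟨$⟩ʳ suc i))
  ≡⟨ cong (𝟙 (P (φ ⟨$⟩ʳ zero)) +_) (count-cong (λ i → cong P (punchIn-permute φ zero i))) ⟩
    𝟙 (P (φ ⟨$⟩ʳ zero)) + count (λ i → P (punchIn (φ ⟨$⟩ʳ zero) (remove zero φ ⟨$⟩ʳ i)))
  ≡⟨ cong (𝟙 (P (φ ⟨$⟩ʳ zero)) +_) (count-permute (remove zero φ) (P ∘ punchIn (φ ⟨$⟩ʳ zero))) ⟩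
    𝟙 (P (φ ⟨$⟩ʳ zero)) + count (P ∘ punchIn (φ ⟨$⟩ʳ zero))
  ≡⟨ sym (count-punchIn P (φ ⟨$⟩ʳ zero)) ⟩
    count P ∎
  where open ≡-Reasoning

full : ∀ {n} → Fin n → Bool
full _ = true

count-all : ∀ {n} → count {n} full ≡ n
count-all {zero} = refl
count-all {suc n} = cong suc (count-all {n})

countBelow : ℕ → (ℕ → Bool) → ℕ
countBelow zero P = 0
countBelow (suc n) P = countBelow n P + 𝟙 (P n)

countBelow-suc : ∀ n P → countBelow (suc n) P ≡ 𝟙 (P 0) + countBelow n (P ∘ suc)
countBelow-suc zero P = +-comm 0 _
countBelow-suc (suc n) P = trans (cong (_+ 𝟙 (P (suc n))) (countBelow-suc n P)) (+-assoc (𝟙 (P 0)) _ _)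

count-toℕ : ∀ n (P : ℕ → Bool) → count {n} (P ∘ toℕ) ≡ countBelow n P
count-toℕ zero P = refl
count-toℕ (suc n) P = trans (cong (𝟙 (P 0) +_) (count-toℕ n (P ∘ suc))) (sym (countBelow-suc n P))

∣∣≡count : ∀ {n} (S : Subset n) → ∣ S ∣ ≡ count (lookup S)
∣∣≡count [] = refl
∣∣≡count (true ∷ S) = cong suc (∣∣≡count S)
∣∣≡count (false ∷ S) = ∣∣≡count S

lookup-∅ : ∀ {n} (i : Fin n) → lookup ∅ i ≡ false
lookup-∅ i = lookup-replicate i false

insert-member : ∀ {n} (S : Subset n) w i → lookup (S [ w ]≔ true) i ≡ true → i ≡ w ⊎ lookup S i ≡ true
insert-member S w i e with i Fin.≟ w
... | yes i≡w = inj₁ i≡w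
... | no i≢w = inj₂ (trans (sym (lookup∘update′ i≢w S true)) e)

insert-old : ∀ {n} (S : Subset n) w i → lookup S i ≡ true → lookup (S [ w ]≔ true) i ≡ true
insert-old S w i Si with i Fin.≟ w
... | yes refl = lookup∘update i S true
... | no i≢w = trans (lookup∘update′ i≢w S true) Si

∣insert∣ : ∀ {n} (S : Subset n) v → lookup S v ≡ false → ∣ S [ v ]≔ true ∣ ≡ suc ∣ S ∣
∣insert∣ S v Sv = begin
    ∣ S [ v ]≔ true ∣
  ≡⟨ ∣∣≡count (S [ v ]≔ true) ⟩
    count (lookup (S [ v ]≔ true))
  ≡⟨ count-remove-member _ v (lookup∘update v S true) ⟩
    suc (count (lookup (S [ v ]≔ true) ─ v))
  ≡⟨ cong suc (count-cong same-outside-v) ⟩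
    suc (count (lookup S))
  ≡⟨ cong suc (sym (∣∣≡count S)) ⟩
    suc ∣ S ∣ ∎
  where
  open ≡-Reasoning
  same-outside-v : ∀ i → (lookup (S [ v ]≔ true) ─ v) i ≡ lookup S i
  same-outside-v i with i Fin.≟ v
  ... | yes refl = trans (∧-zeroʳ _) (sym Sv)
  ... | no i≢v = trans (∧-identityʳ _) (lookup∘update′ i≢v S true)

∣⁅_⁆∣ : ∀ {n} (v : Fin n) → ∣ ∅ [ v ]≔ true ∣ ≡ 1
∣⁅_⁆∣ {n} v = trans (∣insert∣ ∅ v (lookup-∅ v)) (cong suc (∣⊥∣≡0 n))

Σsubsets : ∀ n → (Subset n → ℕ) → ℕ
Σsubsets zero h = h []
Σsubsets (suc n) h = Σsubsets n (h ∘ (true ∷_)) + Σsubsets n (h ∘ (false ∷_))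

Σsubsets-cong : ∀ n {h k : Subset n → ℕ} → (∀ S → h S ≡ k S) → Σsubsets n h ≡ Σsubsets n k
Σsubsets-cong zero e = e []
Σsubsets-cong (suc n) e = cong₂ _+_ (Σsubsets-cong n (e ∘ (true ∷_))) (Σsubsets-cong n (e ∘ (false ∷_)))

Σsubsets-0 : ∀ n → Σsubsets n (λ _ → 0) ≡ 0
Σsubsets-0 zero = refl
Σsubsets-0 (suc n) rewrite Σsubsets-0 n = refl

Σsubsets-+ : ∀ n (h k : Subset n → ℕ) → Σsubsets n (λ S → h S + k S) ≡ Σsubsets n h + Σsubsets n k
Σsubsets-+ zero h k = refl
Σsubsets-+ (suc n) h k
  rewrite Σsubsets-+ n (h ∘ (true ∷_)) (k ∘ (true ∷_)) | Σsubsets-+ n (h ∘ (false ∷_)) (k ∘ (false ∷_)) =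
  +-interchange (Σsubsets n (h ∘ (true ∷_))) _ _ _

length-filter : ∀ {A : Set} {P : A → Set} (P? : ∀ x → Dec (P x)) xs →
                length (filter P? xs) ≡ sum (map (λ x → 𝟙 (does (P? x))) xs)
length-filter P? [] = refl
length-filter P? (x ∷ xs) with P? x
... | yes _ = cong suc (length-filter P? xs)
... | no _ = length-filter P? xs

sum-allSubsets : ∀ n (h : Subset n → ℕ) → sum (map h (allSubsets n)) ≡ Σsubsets n h
sum-allSubsets zero h = +-identityʳ _
sum-allSubsets (suc n) h = begin
    sum (map h (map (true ∷_) (allSubsets n) ++ map (false ∷_) (allSubsets n)))
  ≡⟨ cong sum (map-++ h (map (true ∷_) (allSubsets n)) _) ⟩
    sum (map h (map (true ∷_) (allSubsets n)) ++ map h (map (false ∷_) (allSubsets n)))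
  ≡⟨ sum-++ (map h (map (true ∷_) (allSubsets n))) _ ⟩
    sum (map h (map (true ∷_) (allSubsets n))) + sum (map h (map (false ∷_) (allSubsets n)))
  ≡⟨ cong₂ (λ xs ys → sum xs + sum ys) (sym (map-∘ (allSubsets n))) (sym (map-∘ (allSubsets n))) ⟩
    sum (map (h ∘ (true ∷_)) (allSubsets n)) + sum (map (h ∘ (false ∷_)) (allSubsets n))
  ≡⟨ cong₂ _+_ (sum-allSubsets n _) (sum-allSubsets n _) ⟩
    Σsubsets (suc n) h ∎
  where open ≡-Reasoning

-- Sets containing v correspond to sets avoiding v, by inserting v.
Σsubsets-insert : ∀ {n} (v : Fin n) (h : Subset n → ℕ) →
  Σsubsets n (λ S → if lookup S v then h S else 0) ≡ Σsubsets n (λ S → if lookup S v then 0 else h (S [ v ]≔ true))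
Σsubsets-insert {suc n} zero h = begin
    Σsubsets n (h ∘ (true ∷_)) + Σsubsets n (λ _ → 0)
  ≡⟨ cong (Σsubsets n (h ∘ (true ∷_)) +_) (Σsubsets-0 n) ⟩
    Σsubsets n (h ∘ (true ∷_)) + 0
  ≡⟨ +-comm _ 0 ⟩
    0 + Σsubsets n (h ∘ (true ∷_))
  ≡⟨ cong (_+ Σsubsets n (h ∘ (true ∷_))) (sym (Σsubsets-0 n)) ⟩
    Σsubsets n (λ _ → 0) + Σsubsets n (h ∘ (true ∷_)) ∎
  where open ≡-Reasoning
Σsubsets-insert {suc n} (suc v) h = cong₂ _+_ (Σsubsets-insert v (h ∘ (true ∷_))) (Σsubsets-insert v (h ∘ (false ∷_)))

isEmpty : ∀ {n} → Subset n → Bool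
isEmpty [] = true
isEmpty (b ∷ S) = not b ∧ isEmpty S

Σsubsets-isEmpty : ∀ n → Σsubsets n (λ S → 𝟙 (isEmpty S)) ≡ 1
Σsubsets-isEmpty zero = refl
Σsubsets-isEmpty (suc n) rewrite Σsubsets-0 n = Σsubsets-isEmpty n

isEmpty-complete : ∀ {n} (S : Subset n) → (∀ i → lookup S i ≡ false) → isEmpty S ≡ true
isEmpty-complete [] h = refl
isEmpty-complete (b ∷ S) h rewrite h zero = isEmpty-complete S (h ∘ suc)

isEmpty-sound : ∀ {n} (S : Subset n) → isEmpty S ≡ true → ∀ i → lookup S i ≡ false
isEmpty-sound (false ∷ S) e zero = refl
isEmpty-sound (false ∷ S) e (suc i) = isEmpty-sound S e i

-- Stable sets of the subgraph of G induced by a vertex set U ⊆ Fin n.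
module Stability {n : ℕ} (G : Graph n) where

  StableIn : (Fin n → Bool) → Subset n → Set
  StableIn U S = (∀ i → lookup S i ≡ true → U i ≡ true)
               × (∀ i j → lookup S i ≡ true → lookup S j ≡ true → adj G i j ≡ false)

  stableIn? : ∀ U S → Dec (StableIn U S)
  stableIn? U S = Fin.all? (λ i → (lookup S i Bool.≟ true) →-dec (U i Bool.≟ true))
           ×-dec Fin.all? (λ i → Fin.all? (λ j →
                   (lookup S i Bool.≟ true) →-dec ((lookup S j Bool.≟ true) →-dec (adj G i j Bool.≟ false))))

  ι : (Fin n → Bool) → ℕ
  ι U = Σsubsets n (λ S → 𝟙 (does (stableIn? U S)))

  F≡ι : F G ≡ ι full
  F≡ι = begin
      F G
    ≡⟨ length-filter (stable? G) (allSubsets n) ⟩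
      sum (map (λ S → 𝟙 (does (stable? G S))) (allSubsets n))
    ≡⟨ sum-allSubsets n _ ⟩
      Σsubsets n (λ S → 𝟙 (does (stable? G S)))
    ≡⟨ Σsubsets-cong n (λ S → 𝟙-does-cong (stable? G S) (stableIn? _ S) (stable⇒ S) (⇒stable S)) ⟩
      ι full ∎
    where
    open ≡-Reasoning
    stable⇒ : ∀ S → Stable G S → StableIn full S
    stable⇒ S st = (λ _ _ → refl) , (λ i j Si Sj → st i j (lookup⇒[]= i S Si) (lookup⇒[]= j S Sj))
    ⇒stable : ∀ S → StableIn full S → Stable G S
    ⇒stable S (_ , st) i j i∈S j∈S = st i j ([]=⇒lookup i∈S) ([]=⇒lookup j∈S)

  ι-empty : ∀ U → (∀ i → U i ≡ false) → ι U ≡ 1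
  ι-empty U U-empty = trans (Σsubsets-cong n only-empty) (Σsubsets-isEmpty n)
    where
    only-empty : ∀ S → 𝟙 (does (stableIn? U S)) ≡ 𝟙 (isEmpty S)
    only-empty S = 𝟙-does-cong (stableIn? U S) (T? (isEmpty S))
      (λ (S⊆U , _) → Equivalence.from T-≡ (isEmpty-complete S (λ i → outside-U (S⊆U i))))
      (λ t → let none = isEmpty-sound S (Equivalence.to T-≡ t) in
             (λ i Si → ⊥-elim (true≢false Si (none i))) , (λ i j Si _ → ⊥-elim (true≢false Si (none i))))
      where
      outside-U : ∀ {i} → (lookup S i ≡ true → U i ≡ true) → lookup S i ≡ false
      outside-U {i} S⊆U with true-or-false (lookup S i)
      ... | inj₁ Si = ⊥-elim (true≢false (S⊆U Si) (U-empty i))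
      ... | inj₂ Si = Si

  stableIn-mono : ∀ {U V S} → (∀ i → V i ≡ true → U i ≡ true) → StableIn V S → StableIn U S
  stableIn-mono V⊆U (S⊆V , st) = (λ i Si → V⊆U i (S⊆V i Si)) , st

  stableIn-insert : ∀ {U S w} → StableIn U S → U w ≡ true → (∀ x → lookup S x ≡ true → adj G w x ≡ false) →
                    StableIn U (S [ w ]≔ true)
  stableIn-insert {U} {S} {w} (S⊆U , st) Uw w-free = S+w⊆U , st'
    where
    S+w⊆U : ∀ i → lookup (S [ w ]≔ true) i ≡ true → U i ≡ true
    S+w⊆U i e with insert-member S w i e
    ... | inj₁ refl = Uw
    ... | inj₂ Si = S⊆U i Si
    st' : ∀ i j → lookup (S [ w ]≔ true) i ≡ true → lookup (S [ w ]≔ true) j ≡ true → adj G i j ≡ false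
    st' i j ei ej with insert-member S w i ei | insert-member S w j ej
    ... | inj₁ refl | inj₁ refl = irrefl G i
    ... | inj₁ refl | inj₂ Sj = w-free j Sj
    ... | inj₂ Si | inj₁ refl = trans (adj-sym G i j) (w-free i Si)
    ... | inj₂ Si | inj₂ Sj = st i j Si Sj

  N[_]∩_ : Fin n → (Fin n → Bool) → Fin n → Bool
  (N[ v ]∩ U) i = U i ∧ (i == v ∨ adj G v i)

  _─N[_] : (Fin n → Bool) → Fin n → Fin n → Bool
  (U ─N[ v ]) i = U i ∧ not (i == v ∨ adj G v i)

  count-N[]-split : ∀ U v → count U ≡ count (N[ v ]∩ U) + count (U ─N[ v ])
  count-N[]-split U v = count-split U (λ i → i == v ∨ adj G v i)

  ─N-spec : ∀ U v i → (U ─N[ v ]) i ≡ true → U i ≡ true × i ≢ v × adj G v i ≡ false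
  ─N-spec U v i e with U i | i Fin.≟ v | adj G v i
  ... | true | no i≢v | false = refl , i≢v , refl

  ─N-intro : ∀ U v i → U i ≡ true → i ≢ v → adj G v i ≡ false → (U ─N[ v ]) i ≡ true
  ─N-intro U v i Ui i≢v ¬vi rewrite Ui | ==-false i≢v | ¬vi = refl

  ─N⊆ : ∀ U v i → (U ─N[ v ]) i ≡ true → U i ≡ true
  ─N⊆ U v i e = proj₁ (─N-spec U v i e)

  ─⊆ : ∀ (U : Fin n → Bool) v i → (U ─ v) i ≡ true → U i ≡ true
  ─⊆ U v i e = proj₁ (─-spec U v i e)

  insert⇒stableIn-─N : ∀ {U S v} → lookup S v ≡ false → StableIn U (S [ v ]≔ true) → StableIn (U ─N[ v ]) S
  insert⇒stableIn-─N {U} {S} {v} Sv (S+v⊆U , st) = S⊆U─N[v] , (λ i j Si Sj → st i j (old Si) (old Sj))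
    where
    old : ∀ {i} → lookup S i ≡ true → lookup (S [ v ]≔ true) i ≡ true
    old {i} = insert-old S v i
    S⊆U─N[v] : ∀ i → lookup S i ≡ true → (U ─N[ v ]) i ≡ true
    S⊆U─N[v] i Si = ─N-intro U v i (S+v⊆U i (old Si)) (λ { refl → true≢false Si Sv })
                              (st v i (lookup∘update v S true) (old Si))

  stableIn-─N⇒insert : ∀ {U S v} → U v ≡ true → StableIn (U ─N[ v ]) S → StableIn U (S [ v ]≔ true)
  stableIn-─N⇒insert {U} {S} {v} Uv (S⊆ , st) =
    stableIn-insert {U} {S} ((λ i Si → ─N⊆ U v i (S⊆ i Si)) , st) Uv (λ x Sx → proj₂ (proj₂ (─N-spec U v x (S⊆ x Sx))))

  ─N-avoids : ∀ U v S → StableIn (U ─N[ v ]) S → lookup S v ≡ false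
  ─N-avoids U v S (S⊆ , _) with true-or-false (lookup S v)
  ... | inj₁ Sv = ⊥-elim (proj₁ (proj₂ (─N-spec U v v (S⊆ v Sv))) refl)
  ... | inj₂ Sv = Sv

  χ : (Fin n → Bool) → Subset n → ℕ
  χ U S = 𝟙 (does (stableIn? U S))

  χ-absent : ∀ U S → ¬ StableIn U S → χ U S ≡ 0
  χ-absent U S ¬st = cong 𝟙 (dec-false (stableIn? U S) ¬st)

  -- The fundamental recurrence: split the stable sets of G[U] according to whether they contain v.
  ι-recurrence : ∀ U v → U v ≡ true → ι U ≡ ι (U ─ v) + ι (U ─N[ v ])
  ι-recurrence U v Uv = begin
      ι U
    ≡⟨ Σsubsets-cong n (λ S → split-on (lookup S v) (χ U S)) ⟩
      Σsubsets n (λ S → (if lookup S v then 0 else χ U S) + (if lookup S v then χ U S else 0))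
    ≡⟨ Σsubsets-+ n _ _ ⟩
      Σsubsets n (λ S → if lookup S v then 0 else χ U S) + Σsubsets n (λ S → if lookup S v then χ U S else 0)
    ≡⟨ cong₂ _+_ (Σsubsets-cong n avoiding-v) (trans (Σsubsets-insert v (χ U)) (Σsubsets-cong n containing-v)) ⟩
      ι (U ─ v) + ι (U ─N[ v ]) ∎
    where
    open ≡-Reasoning
    split-on : ∀ b x → x ≡ (if b then 0 else x) + (if b then x else 0)
    split-on true x = refl
    split-on false x = sym (+-identityʳ x)
    avoiding-v : ∀ S → (if lookup S v then 0 else χ U S) ≡ χ (U ─ v) S
    avoiding-v S with lookup S v in Sv
    ... | true = sym (χ-absent (U ─ v) S (λ (S⊆ , _) → proj₂ (─-spec U v v (S⊆ v Sv)) refl))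
    ... | false = 𝟙-does-cong (stableIn? U S) (stableIn? (U ─ v) S)
      (λ (S⊆U , st) → (λ i Si → ─-intro U v i (S⊆U i Si) (λ { refl → true≢false Si Sv })) , st)
      (stableIn-mono {U} {U ─ v} {S} (─⊆ U v))
    containing-v : ∀ S → (if lookup S v then 0 else χ U (S [ v ]≔ true)) ≡ χ (U ─N[ v ]) S
    containing-v S with lookup S v in Sv
    ... | true = sym (χ-absent (U ─N[ v ]) S (λ (S⊆ , _) → proj₁ (proj₂ (─N-spec U v v (S⊆ v Sv))) refl))
    ... | false = 𝟙-does-cong (stableIn? U (S [ v ]≔ true)) (stableIn? (U ─N[ v ]) S)
      (insert⇒stableIn-─N {U} {S} Sv) (stableIn-─N⇒insert {U} {S} Uv)

  stableIn-∅ : ∀ U → StableIn U ∅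
  stableIn-∅ U = (λ i e → ⊥-elim (true≢false e (lookup-∅ i))) , (λ i j e _ → ⊥-elim (true≢false e (lookup-∅ i)))

  stableIn-⁅⁆ : ∀ U v → U v ≡ true → StableIn U (∅ [ v ]≔ true)
  stableIn-⁅⁆ U v Uv = stableIn-insert {U} {∅} (stableIn-∅ U) Uv (λ x e → ⊥-elim (true≢false e (lookup-∅ x)))

  StabilityAtMost : (Fin n → Bool) → ℕ → Set
  StabilityAtMost U a = ∀ S → StableIn U S → ∣ S ∣ ≤ a

  atMost-mono : ∀ {U V a} → (∀ i → V i ≡ true → U i ≡ true) → StabilityAtMost U a → StabilityAtMost V a
  atMost-mono {U} {V} V⊆U bound S st = bound S (stableIn-mono {U} {V} {S} V⊆U st)

  -- Every stable set of U ─ N[v] extends by v, so α drops by one.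
  atMost-─N : ∀ {U v a} → U v ≡ true → StabilityAtMost U (suc a) → StabilityAtMost (U ─N[ v ]) a
  atMost-─N {U} {v} {a} Uv bound S st =
    ≤-pred (subst (_≤ suc a) (∣insert∣ S v (─N-avoids U v S st)) (bound (S [ v ]≔ true) (stableIn-─N⇒insert {U} {S} Uv st)))

  count-─N-< : ∀ U v → U v ≡ true → count (U ─N[ v ]) < count U
  count-─N-< U v Uv = subst (count (U ─N[ v ]) <_) (sym (count-N[]-split U v))
    (+-monoˡ-≤ (count (U ─N[ v ])) (count-pos (N[ v ]∩ U) v (∧-intro Uv (cong (_∨ adj G v v) (==-refl v)))))

  N[]≤ : ∀ U v {m} → count U ≡ m → count (N[ v ]∩ U) ≤ m
  N[]≤ U v |U| = subst (count (N[ v ]∩ U) ≤_) (trans (sym (count-N[]-split U v)) |U|) (m≤m+n _ _)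

divmod-% : ∀ {b} q p → p < suc b → (p + q * suc b) % suc b ≡ p
divmod-% {b} q p p<d = trans ([m+kn]%n≡m%n p q (suc b)) (m<n⇒m%n≡m p<d)

divmod-/ : ∀ {b} q p → p < suc b → (p + q * suc b) / suc b ≡ q
divmod-/ {b} q p p<d = begin
    (p + q * suc b) / suc b
  ≡⟨ +-distrib-/ p (q * suc b) no-carry ⟩
    p / suc b + q * suc b / suc b
  ≡⟨ cong₂ _+_ (m<n⇒m/n≡0 p<d) (m*n/n≡m q (suc b)) ⟩
    q ∎
  where
  open ≡-Reasoning
  no-carry : p % suc b + q * suc b % suc b < suc b
  no-carry = subst (_< suc b) (sym (trans (cong₂ _+_ (m<n⇒m%n≡m p<d) (m*n%n≡0 q (suc b))) (+-identityʳ p))) p<d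

divmod-suc-< : ∀ m b → m % suc b < b → (suc m / suc b ≡ m / suc b) × (suc m % suc b ≡ suc (m % suc b))
divmod-suc-< m b p<b =
  trans (cong (λ x → suc x / suc b) (m≡m%n+[m/n]*n m (suc b))) (divmod-/ (m / suc b) (suc (m % suc b)) (s≤s p<b)) ,
  trans (cong (λ x → suc x % suc b) (m≡m%n+[m/n]*n m (suc b))) (divmod-% (m / suc b) (suc (m % suc b)) (s≤s p<b))

divmod-suc-≡ : ∀ m b → m % suc b ≡ b → (suc m / suc b ≡ suc (m / suc b)) × (suc m % suc b ≡ 0)
divmod-suc-≡ m b p≡b =
  trans (cong (_/ suc b) suc-m≡) (divmod-/ {b} (suc (m / suc b)) 0 (s≤s z≤n)) ,
  trans (cong (_% suc b) suc-m≡) (divmod-% {b} (suc (m / suc b)) 0 (s≤s z≤n))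
  where
  suc-m≡ : suc m ≡ 0 + suc (m / suc b) * suc b
  suc-m≡ = trans (cong suc (trans (m≡m%n+[m/n]*n m (suc b)) (cong (_+ m / suc b * suc b) p≡b))) (sym (+-identityˡ _))

-- (q+2)^p (q+1)^(a−p): the number of stable sets of p disjoint cliques of order q + 1
-- together with a − p disjoint cliques of order q.
cliqueProduct : ℕ → ℕ → ℕ → ℕ
cliqueProduct q p a = suc (suc q) ^ p * suc q ^ (a ∸ p)

-- τ m a is the value f_T(m, a) of the theorem: m vertices split into a balanced cliques.
τ : ℕ → ℕ → ℕ
τ m zero = 1
τ m (suc b) = cliqueProduct (m / suc b) (m % suc b) (suc b)

τ-divmod : ∀ {b} q p → p < suc b → τ (p + q * suc b) (suc b) ≡ cliqueProduct q p (suc b)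
τ-divmod q p p<d rewrite divmod-/ q p p<d | divmod-% q p p<d = refl

τ-multiple : ∀ x b → τ (x * b) b ≡ suc x ^ b
τ-multiple x zero = refl
τ-multiple x (suc b) = trans (τ-divmod x 0 (s≤s z≤n)) (+-identityʳ _)

τ-pos : ∀ m b → 1 ≤ τ m b
τ-pos m zero = s≤s z≤n
τ-pos m (suc b) = *-mono-≤ {1} {_} {1} (m^n>0 (suc (suc (m / suc b))) (m % suc b)) (m^n>0 (suc (m / suc b)) (suc b ∸ m % suc b))

-- One more vertex when m = p + q(b + 1) with p < b: it enlarges a clique of order q.
τ-recurrence-< : ∀ q p b → p < b → τ (suc p + q * suc b) (suc b) ≡ cliqueProduct q p (suc b) + τ (p + q * b) b
τ-recurrence-< q p (suc b) p<b = begin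
    τ (suc p + q * suc (suc b)) (suc (suc b))
  ≡⟨ τ-divmod q (suc p) (s≤s p<b) ⟩
    suc (suc q) ^ suc p * suc q ^ (suc b ∸ p)
  ≡⟨ solve 3 (λ q X Y → ((con 2 :+ q) :* X) :* Y := X :* ((con 1 :+ q) :* Y) :+ X :* Y) refl q (suc (suc q) ^ p) (suc q ^ (suc b ∸ p)) ⟩
    suc (suc q) ^ p * suc q ^ suc (suc b ∸ p) + cliqueProduct q p (suc b)
  ≡⟨ cong₂ (λ e x → suc (suc q) ^ p * suc q ^ e + x) (sym (+-∸-assoc 1 (<⇒≤ p<b))) (sym (τ-divmod q p p<b)) ⟩
    cliqueProduct q p (suc (suc b)) + τ (p + q * suc b) (suc b) ∎
  where open ≡-Reasoning

-- One more vertex when m = b + q(b + 1): all b + 1 cliques now have order q + 1.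
τ-recurrence-≡ : ∀ q b → τ (suc q * suc b) (suc b) ≡ cliqueProduct q b (suc b) + τ (suc q * b) b
τ-recurrence-≡ q b = begin
    τ (suc q * suc b) (suc b)
  ≡⟨ τ-multiple (suc q) (suc b) ⟩
    suc (suc q) ^ suc b
  ≡⟨ solve 2 (λ q X → (con 2 :+ q) :* X := X :* ((con 1 :+ q) :* con 1) :+ X) refl q (suc (suc q) ^ b) ⟩
    suc (suc q) ^ b * (suc q ^ 1) + suc (suc q) ^ b
  ≡⟨ cong₂ (λ e x → suc (suc q) ^ b * suc q ^ e + x) (sym (m+n∸n≡m 1 b)) (sym (τ-multiple (suc q) b)) ⟩
    cliqueProduct q b (suc b) + τ (suc q * b) b ∎
  where open ≡-Reasoning

-- The recurrence τ(m+1, b+1) = τ(m, b+1) + τ(m+1 − ⌈(m+1)/(b+1)⌉, b): in the Turán graph,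
-- delete a vertex v of a largest clique, or delete its closed neighbourhood (that clique).
τ-recurrence : ∀ m b → τ (suc m) (suc b) ≡ τ m (suc b) + τ (suc m ∸ suc (m / suc b)) b
τ-recurrence m b = subst (λ x → τ (suc x) (suc b) ≡ τ x (suc b) + τ (suc x ∸ suc (m / suc b)) b)
  (sym (m≡m%n+[m/n]*n m (suc b))) (on-divmod (m / suc b) (m % suc b) (m%n<n m (suc b)))
  where
  rest : ∀ p q → p + q * suc b ∸ q ≡ p + q * b
  rest p q = trans (cong (_∸ q) (solve 3 (λ p q b → p :+ q :* (con 1 :+ b) := q :+ (p :+ q :* b)) refl p q b))
                   (m+n∸m≡n q (p + q * b))
  on-divmod : ∀ q p → p < suc b → τ (suc (p + q * suc b)) (suc b) ≡ τ (p + q * suc b) (suc b) + τ (p + q * suc b ∸ q) b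
  on-divmod q p p<d rewrite rest p q | τ-divmod q p p<d with <-cmp p b
  ... | tri< p<b _ _ = τ-recurrence-< q p b p<b
  ... | tri≈ _ refl _ = τ-recurrence-≡ q p
  ... | tri> _ _ p>b = ⊥-elim (<-irrefl refl (≤-trans p<d p>b))

τ-step : ∀ m b → τ m b ≤ τ (suc m) b
τ-step m zero = ≤-refl
τ-step m (suc b) rewrite τ-recurrence m b = m≤m+n _ _

τ-mono : ∀ {x y} b → x ≤ y → τ x b ≤ τ y b
τ-mono {x} {y} b x≤y with m≤n⇒m<n∨m≡n x≤y
... | inj₂ refl = ≤-refl
τ-mono {x} {suc y} b _ | inj₁ (s≤s x≤y) = ≤-trans (τ-mono b x≤y) (τ-step y b)

τ-strict-step : ∀ m b → τ m (suc b) < τ (suc m) (suc b)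
τ-strict-step m b rewrite τ-recurrence m b =
  subst (_≤ τ m (suc b) + τ (suc m ∸ suc (m / suc b)) b) (+-comm (τ m (suc b)) 1)
        (+-monoʳ-≤ (τ m (suc b)) (τ-pos (suc m ∸ suc (m / suc b)) b))

τ-strict-mono : ∀ {x y} b → x < y → τ x (suc b) < τ y (suc b)
τ-strict-mono {x} {suc y} b (s≤s x≤y) with m≤n⇒m<n∨m≡n x≤y
... | inj₂ refl = τ-strict-step x b
... | inj₁ x<y = <-trans (τ-strict-mono b x<y) (τ-strict-step y b)

+-tight : ∀ {a b x y} → a ≤ x → b ≤ y → a + b ≡ x + y → a ≡ x × b ≡ y
+-tight a≤x b≤y e with m≤n⇒m<n∨m≡n a≤x | m≤n⇒m<n∨m≡n b≤y
... | inj₂ a≡x | inj₂ b≡y = a≡x , b≡y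
... | inj₁ a<x | _ = ⊥-elim (<-irrefl e (+-mono-<-≤ a<x b≤y))
... | inj₂ a≡x | inj₁ b<y = ⊥-elim (<-irrefl e (+-mono-≤-< a≤x b<y))

ceiling-not-divisible : ∀ n b p → n % suc b ≡ suc p → ⌈ n / suc b ⌉ ≡ suc (n / suc b)
ceiling-not-divisible n b p n%d≡1+p = begin
    (n + b) / suc b
  ≡⟨ cong (λ x → (x + b) / suc b) (trans (m≡m%n+[m/n]*n n (suc b)) (cong (_+ q * suc b) n%d≡1+p)) ⟩
    (suc p + q * suc b + b) / suc b
  ≡⟨ cong (_/ suc b) (solve 3 (λ p q b → con 1 :+ p :+ q :* (con 1 :+ b) :+ b := p :+ (con 1 :+ q) :* (con 1 :+ b)) refl p q b) ⟩
    (p + suc q * suc b) / suc b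
  ≡⟨ divmod-/ (suc q) p (<-trans (n<1+n p) (subst (_< suc b) n%d≡1+p (m%n<n n (suc b)))) ⟩
    suc q ∎
  where
  open ≡-Reasoning
  q : ℕ
  q = n / suc b

τ-closed-form : ∀ n b → τ n (suc b) ≡ (⌈ n / suc b ⌉ + 1) ^ (n % suc b) * (n / suc b + 1) ^ (suc b ∸ n % suc b)
τ-closed-form n b with n % suc b in n%d
... | zero = cong (λ x → 1 * x ^ suc b) (+-comm 1 (n / suc b))
... | suc p rewrite ceiling-not-divisible n b p n%d =
  cong₂ (λ x y → x ^ suc p * y ^ (suc b ∸ suc p)) (+-comm 1 (suc (n / suc b))) (+-comm 1 (n / suc b))

balancedSize : ℕ → ℕ → ℕ → ℕ
balancedSize m b r = m / suc b + 𝟙 (r <ᵇ m % suc b)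

𝟙<ᵇ-suc : ∀ r p → 𝟙 (r <ᵇ p) + 𝟙 (p ≡ᵇ r) ≡ 𝟙 (r <ᵇ suc p)
𝟙<ᵇ-suc zero zero = refl
𝟙<ᵇ-suc zero (suc p) = refl
𝟙<ᵇ-suc (suc r) zero = refl
𝟙<ᵇ-suc (suc r) (suc p) = 𝟙<ᵇ-suc r p

balancedSize-suc : ∀ m b r → r < suc b → balancedSize (suc m) b r ≡ balancedSize m b r + 𝟙 (m % suc b ≡ᵇ r)
balancedSize-suc m b r r<d with <-cmp (m % suc b) b
... | tri< p<b _ _ rewrite divmod-suc-< m b p<b .proj₁ | divmod-suc-< m b p<b .proj₂ =
  sym (trans (+-assoc (m / suc b) _ _) (cong (m / suc b +_) (𝟙<ᵇ-suc r (m % suc b))))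
... | tri≈ _ p≡b _ rewrite divmod-suc-≡ m b p≡b .proj₁ | divmod-suc-≡ m b p≡b .proj₂ | p≡b = sym (begin
    m / suc b + 𝟙 (r <ᵇ b) + 𝟙 (b ≡ᵇ r)
  ≡⟨ +-assoc (m / suc b) _ _ ⟩
    m / suc b + (𝟙 (r <ᵇ b) + 𝟙 (b ≡ᵇ r))
  ≡⟨ cong (m / suc b +_) (trans (𝟙<ᵇ-suc r b) (cong 𝟙 (<ᵇ-true r<d))) ⟩
    m / suc b + 1
  ≡⟨ +-comm (m / suc b) 1 ⟩
    suc (m / suc b)
  ≡⟨ +-identityʳ _ ⟨
    suc (m / suc b) + 0 ∎)
  where open ≡-Reasoning
... | tri> _ _ p>b = ⊥-elim (<-irrefl refl (≤-trans (m%n<n m (suc b)) p>b))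

residue-classes : ∀ n b r → r < suc b → countBelow n (λ i → i % suc b ≡ᵇ r) ≡ balancedSize n b r
residue-classes zero b r r<d = refl
residue-classes (suc n) b r r<d =
  trans (cong (_+ 𝟙 (n % suc b ≡ᵇ r)) (residue-classes n b r r<d)) (sym (balancedSize-suc n b r r<d))

∏< : ℕ → (ℕ → ℕ) → ℕ
∏< zero h = 1
∏< (suc a) h = h 0 * ∏< a (h ∘ suc)

∏<-cong : ∀ a {h k : ℕ → ℕ} → (∀ r → r < a → h r ≡ k r) → ∏< a h ≡ ∏< a k
∏<-cong zero e = refl
∏<-cong (suc a) e = cong₂ _*_ (e 0 (s≤s z≤n)) (∏<-cong a (λ r r<a → e (suc r) (s≤s r<a)))

∏<-1 : ∀ a → ∏< a (λ _ → 1) ≡ 1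
∏<-1 zero = refl
∏<-1 (suc a) = trans (+-identityʳ _) (∏<-1 a)

∏<-pick : ∀ a (h : ℕ → ℕ) j → j < a → ∏< a h ≡ h j * ∏< a (λ r → if r ≡ᵇ j then 1 else h r)
∏<-pick (suc a) h zero _ = cong (h 0 *_) (sym (+-identityʳ _))
∏<-pick (suc a) h (suc j) (s≤s j<a) = trans (cong (h 0 *_) (∏<-pick a (h ∘ suc) j j<a))
  (*-swap (h 0) (h (suc j)) _)

∏<-step : ∀ a j → j < a → (s s₁ s₂ : ℕ → ℕ) → s j ≡ suc (s₁ j) → s₂ j ≡ 0 →
          (∀ r → (r ≡ᵇ j) ≡ false → s₁ r ≡ s r) → (∀ r → (r ≡ᵇ j) ≡ false → s₂ r ≡ s r) →
          ∏< a (suc ∘ s₁) + ∏< a (suc ∘ s₂) ≡ ∏< a (suc ∘ s)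
∏<-step a j j<a s s₁ s₂ sj s₂j same₁ same₂ = begin
    ∏< a (suc ∘ s₁) + ∏< a (suc ∘ s₂)
  ≡⟨ cong₂ _+_ (∏<-pick a (suc ∘ s₁) j j<a) (∏<-pick a (suc ∘ s₂) j j<a) ⟩
    suc (s₁ j) * rest s₁ + suc (s₂ j) * rest s₂
  ≡⟨ cong₂ (λ x y → suc (s₁ j) * x + suc y * rest s₂) (∏<-cong a (λ r _ → off-j s₁ s same₁ r)) s₂j ⟩
    suc (s₁ j) * rest s + (rest s₂ + 0)
  ≡⟨ cong (λ x → suc (s₁ j) * rest s + (x + 0)) (∏<-cong a (λ r _ → off-j s₂ s same₂ r)) ⟩
    suc (s₁ j) * rest s + (rest s + 0)
  ≡⟨ solve 2 (λ x R → (con 1 :+ x) :* R :+ (R :+ con 0) := (con 2 :+ x) :* R) refl (s₁ j) (rest s) ⟩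
    suc (suc (s₁ j)) * rest s
  ≡⟨ cong (λ x → suc x * rest s) (sym sj) ⟩
    suc (s j) * rest s
  ≡⟨ sym (∏<-pick a (suc ∘ s) j j<a) ⟩
    ∏< a (suc ∘ s) ∎
  where
  open ≡-Reasoning
  rest : (ℕ → ℕ) → ℕ
  rest t = ∏< a (λ r → if r ≡ᵇ j then 1 else suc (t r))
  off-j : ∀ t t′ → (∀ r → (r ≡ᵇ j) ≡ false → t r ≡ t′ r) → ∀ r →
          (if r ≡ᵇ j then 1 else suc (t r)) ≡ (if r ≡ᵇ j then 1 else suc (t′ r))
  off-j t t′ same r with r ≡ᵇ j in r≢j
  ... | true = refl
  ... | false = cong suc (same r r≢j)

∏<-balanced : ∀ m b → ∏< (suc b) (λ r → suc (balancedSize m b r)) ≡ τ m (suc b)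
∏<-balanced m b = go (suc b) (m % suc b) (m / suc b) (<⇒≤ (m%n<n m (suc b)))
  where
  go : ∀ a p q → p ≤ a → ∏< a (λ r → suc (q + 𝟙 (r <ᵇ p))) ≡ cliqueProduct q p a
  go zero zero q _ = refl
  go (suc a) zero q _ = trans (cong₂ _*_ (cong suc (+-identityʳ q)) (go a zero q z≤n))
                              (sym (trans (*-identityˡ _) (cong (suc q *_) (sym (*-identityˡ _)))))
  go (suc a) (suc p) q (s≤s p≤a) = trans (cong₂ _*_ (cong suc (+-comm q 1)) (go a p q p≤a))
                                         (sym (*-assoc (suc (suc q)) (suc (suc q) ^ p) (suc q ^ (a ∸ p))))

-- Induced subgraphs that are disjoint unions of cliques, described by a labelling of the vertices.
module Clusters {n : ℕ} (G : Graph n) where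
  open Stability G

  ClusterOn : (Fin n → Bool) → (Fin n → ℕ) → Set
  ClusterOn U cl = ∀ u w → U u ≡ true → U w ≡ true → adj G u w ≡ not (u == w) ∧ (cl u ≡ᵇ cl w)

  LabelsBelow : (Fin n → Bool) → (Fin n → ℕ) → ℕ → Set
  LabelsBelow U cl a = ∀ u → U u ≡ true → cl u < a

  classSize : (Fin n → Bool) → (Fin n → ℕ) → ℕ → ℕ
  classSize U cl r = count (λ u → U u ∧ (cl u ≡ᵇ r))

  cluster-mono : ∀ {U V cl} → (∀ i → V i ≡ true → U i ≡ true) → ClusterOn U cl → ClusterOn V cl
  cluster-mono V⊆U c u w Vu Vw = c u w (V⊆U u Vu) (V⊆U w Vw)

  labels-mono : ∀ {U V cl a} → (∀ i → V i ≡ true → U i ≡ true) → LabelsBelow U cl a → LabelsBelow V cl a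
  labels-mono V⊆U lab u Vu = lab u (V⊆U u Vu)

  classSize-─ : ∀ U cl v r → U v ≡ true → classSize U cl r ≡ 𝟙 (cl v ≡ᵇ r) + classSize (U ─ v) cl r
  classSize-─ U cl v r Uv = trans (count-remove _ v) (cong₂ _+_ (cong (λ b → 𝟙 (b ∧ (cl v ≡ᵇ r))) Uv)
    (count-cong (λ u → reorder (U u) (cl u ≡ᵇ r) (not (u == v)))))
    where
    reorder : ∀ a c e → (a ∧ c) ∧ e ≡ (a ∧ e) ∧ c
    reorder a c e = trans (∧-assoc a c e) (trans (cong (a ∧_) (∧-comm c e)) (sym (∧-assoc a e c)))

  N[]-is-class : ∀ U cl v → ClusterOn U cl → U v ≡ true → ∀ u → U u ≡ true → (u == v ∨ adj G v u) ≡ (cl u ≡ᵇ cl v)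
  N[]-is-class U cl v c Uv u Uu with u Fin.≟ v
  ... | yes refl = sym (≡ᵇ-refl (cl u))
  ... | no u≢v rewrite c v u Uv Uu | ==-false (u≢v ∘ sym) = ≡ᵇ-sym (cl v) (cl u)

  classSize-─N-own : ∀ U cl v → ClusterOn U cl → U v ≡ true → classSize (U ─N[ v ]) cl (cl v) ≡ 0
  classSize-─N-own U cl v c Uv = count-none _ outside
    where
    outside : ∀ u → (U ─N[ v ]) u ∧ (cl u ≡ᵇ cl v) ≡ false
    outside u with U u in Uu
    ... | false = refl
    ... | true rewrite N[]-is-class U cl v c Uv u Uu with cl u ≡ᵇ cl v
    ... | true = refl
    ... | false = refl

  classSize-─N-other : ∀ U cl v r → ClusterOn U cl → U v ≡ true → (r ≡ᵇ cl v) ≡ false →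
                       classSize (U ─N[ v ]) cl r ≡ classSize U cl r
  classSize-─N-other U cl v r c Uv r≢v = count-cong same
    where
    same : ∀ u → (U ─N[ v ]) u ∧ (cl u ≡ᵇ r) ≡ U u ∧ (cl u ≡ᵇ r)
    same u with U u in Uu
    ... | false = refl
    ... | true rewrite N[]-is-class U cl v c Uv u Uu with cl u ≡ᵇ r in u∈r
    ... | false = ∧-zeroʳ _
    ... | true = trans (∧-identityʳ _) (cong not (trans (cong (_≡ᵇ cl v) (≡ᵇ-sound {cl u} u∈r)) r≢v))

  cluster-count : ∀ a cl U → ClusterOn U cl → LabelsBelow U cl a → ι U ≡ ∏< a (λ r → suc (classSize U cl r))
  cluster-count a cl = count-induction _ step
    where
    step : ∀ U → (∀ V → count V < count U → ClusterOn V cl → LabelsBelow V cl a → ι V ≡ ∏< a (λ r → suc (classSize V cl r))) →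
           ClusterOn U cl → LabelsBelow U cl a → ι U ≡ ∏< a (λ r → suc (classSize U cl r))
    step U ih c lab with none-or-witness U
    ... | inj₁ empty = trans (ι-empty U empty)
          (sym (trans (∏<-cong a (λ r _ → cong suc (count-none _ (λ u → cong (_∧ (cl u ≡ᵇ r)) (empty u))))) (∏<-1 a)))
    ... | inj₂ (v , Uv) = begin
        ι U
      ≡⟨ ι-recurrence U v Uv ⟩
        ι (U ─ v) + ι (U ─N[ v ])
      ≡⟨ cong₂ _+_ (ih (U ─ v) (count-─-< U v Uv) (cluster-mono {U} {U ─ v} {cl} (─⊆ U v) c) (labels-mono {U} {U ─ v} {cl} (─⊆ U v) lab))
                   (ih (U ─N[ v ]) (count-─N-< U v Uv) (cluster-mono {U} {U ─N[ v ]} {cl} (─N⊆ U v) c) (labels-mono {U} {U ─N[ v ]} {cl} (─N⊆ U v) lab)) ⟩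
        ∏< a (λ r → suc (classSize (U ─ v) cl r)) + ∏< a (λ r → suc (classSize (U ─N[ v ]) cl r))
      ≡⟨ ∏<-step a (cl v) (lab v Uv) (classSize U cl) (classSize (U ─ v) cl) (classSize (U ─N[ v ]) cl)
           own-class-shrinks (classSize-─N-own U cl v c Uv) other-classes-kept (λ r → classSize-─N-other U cl v r c Uv) ⟩
        ∏< a (λ r → suc (classSize U cl r)) ∎
      where
      open ≡-Reasoning
      own-class-shrinks : classSize U cl (cl v) ≡ suc (classSize (U ─ v) cl (cl v))
      own-class-shrinks = trans (classSize-─ U cl v (cl v) Uv) (cong (λ b → 𝟙 b + classSize (U ─ v) cl (cl v)) (≡ᵇ-refl (cl v)))
      other-classes-kept : ∀ r → (r ≡ᵇ cl v) ≡ false → classSize (U ─ v) cl r ≡ classSize U cl r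
      other-classes-kept r r≢v = sym (trans (classSize-─ U cl v r Uv)
        (cong (λ b → 𝟙 b + classSize (U ─ v) cl r) (trans (≡ᵇ-sym (cl v) r) r≢v)))

  Balanced : (Fin n → Bool) → ℕ → ℕ → (Fin n → ℕ) → Set
  Balanced U m b cl = ClusterOn U cl × LabelsBelow U cl (suc b) × (∀ r → r < suc b → classSize U cl r ≡ balancedSize m b r)

  balanced-count : ∀ U m b cl → Balanced U m b cl → ι U ≡ τ m (suc b)
  balanced-count U m b cl (c , lab , sizes) = begin
      ι U
    ≡⟨ cluster-count (suc b) cl U c lab ⟩
      ∏< (suc b) (λ r → suc (classSize U cl r))
    ≡⟨ ∏<-cong (suc b) (λ r r<a → cong suc (sizes r r<a)) ⟩
      ∏< (suc b) (λ r → suc (balancedSize m b r))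
    ≡⟨ ∏<-balanced m b ⟩
      τ m (suc b) ∎
    where open ≡-Reasoning

turanAdj≡ : ∀ {n} b (u w : Fin n) → turanAdj (suc b) u w ≡ not (u == w) ∧ (toℕ u % suc b ≡ᵇ toℕ w % suc b)
turanAdj≡ b u w with toℕ u ≟ toℕ w
... | yes u≡w rewrite Fin.toℕ-injective {i = u} {w} u≡w | ==-refl w = refl
... | no u≢w with toℕ u % suc b ≟ toℕ w % suc b
...   | yes same rewrite ==-false {i = u} {w} (u≢w ∘ cong toℕ) = sym (≡ᵇ-true same)
...   | no different rewrite ==-false {i = u} {w} (u≢w ∘ cong toℕ) = sym (≡ᵇ-false different)

turan-balanced : ∀ n b → Clusters.Balanced (Turan n (suc b)) full n b (λ i → toℕ i % suc b)
turan-balanced n b = (λ u w _ _ → turanAdj≡ b u w) , (λ u _ → m%n<n (toℕ u) (suc b)) ,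
  (λ r r<a → trans (count-toℕ n (λ i → i % suc b ≡ᵇ r)) (residue-classes n b r r<a))

fT≡τ : ∀ n b → fT n (suc b) ≡ τ n (suc b)
fT≡τ n b = trans (Stability.F≡ι (Turan n (suc b)))
  (Clusters.balanced-count (Turan n (suc b)) _ n b _ (turan-balanced n b))

module UpperBound {n : ℕ} (G : Graph n) where
  open Stability G

  N[]-mono : ∀ {U V} w → (∀ i → V i ≡ true → U i ≡ true) → ∀ i → (N[ w ]∩ V) i ≡ true → (N[ w ]∩ U) i ≡ true
  N[]-mono {U} {V} w V⊆U i e = ∧-intro (V⊆U i (∧-elimˡ (V i) e)) (∧-elimʳ (V i) e)

  -- If all closed neighbourhoods in U have at most k vertices, picking vertices greedily
  -- gives a stable set S inside U with |U| ≤ k · |S|.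
  greedy-stable : ∀ k U → (∀ v → U v ≡ true → count (N[ v ]∩ U) ≤ k) →
                  Σ (Subset n) λ S → StableIn U S × count U ≤ k * ∣ S ∣
  greedy-stable k = count-induction _ step
    where
    step : ∀ U → (∀ V → count V < count U → (∀ v → V v ≡ true → count (N[ v ]∩ V) ≤ k) →
                   Σ (Subset n) λ S → StableIn V S × count V ≤ k * ∣ S ∣) →
           (∀ v → U v ≡ true → count (N[ v ]∩ U) ≤ k) → Σ (Subset n) λ S → StableIn U S × count U ≤ k * ∣ S ∣
    step U ih small with none-or-witness U
    ... | inj₁ empty = ∅ , stableIn-∅ U , subst (_≤ k * ∣ ∅ {n} ∣) (sym (count-none U empty)) z≤n
    ... | inj₂ (v , Uv) with ih (U ─N[ v ]) (count-─N-< U v Uv)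
                              (λ w e → ≤-trans (count-mono _ _ (N[]-mono w (─N⊆ U v))) (small w (─N⊆ U v w e)))
    ... | S , st , bound = S [ v ]≔ true , stableIn-─N⇒insert {U} {S} Uv st , (begin
        count U
      ≡⟨ count-N[]-split U v ⟩
        count (N[ v ]∩ U) + count (U ─N[ v ])
      ≤⟨ +-mono-≤ (small v Uv) bound ⟩
        k + k * ∣ S ∣
      ≡⟨ *-suc k ∣ S ∣ ⟨
        k * suc ∣ S ∣
      ≡⟨ cong (k *_) (∣insert∣ S v v∉S) ⟨
        k * ∣ S [ v ]≔ true ∣ ∎)
      where
      open ≤-Reasoning
      v∉S : lookup S v ≡ false
      v∉S = ─N-avoids U v S st

  -- If |U| = m + 1 and α(G[U]) ≤ b + 1, some vertex has |N[v] ∩ U| ≥ ⌈(m + 1)/(b + 1)⌉ = ⌊m/(b + 1)⌋ + 1: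
  -- otherwise the greedy stable set would exceed b + 1 vertices.
  high-degree-vertex : ∀ U m b → count U ≡ suc m → StabilityAtMost U (suc b) →
                       Σ (Fin n) λ v → U v ≡ true × suc (m / suc b) ≤ count (N[ v ]∩ U)
  high-degree-vertex U m b |U| bound with Fin.any? (λ v → (U v Bool.≟ true) ×-dec (suc (m / suc b) ≤? count (N[ v ]∩ U)))
  ... | yes found = found
  ... | no none = ⊥-elim (<-irrefl refl (begin-strict
      m
    <⟨ n<1+n m ⟩
      suc m
    ≡⟨ |U| ⟨
      count U
    ≤⟨ proj₂ (proj₂ greedy) ⟩
      m / suc b * ∣ S ∣
    ≤⟨ *-monoʳ-≤ (m / suc b) (bound S (proj₁ (proj₂ greedy))) ⟩
      m / suc b * suc b
    ≤⟨ m/n*n≤m m (suc b) ⟩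
      m ∎))
    where
    open ≤-Reasoning
    greedy : Σ (Subset n) λ S → StableIn U S × count U ≤ m / suc b * ∣ S ∣
    greedy = greedy-stable (m / suc b) U (λ v Uv → ≤-pred (≰⇒> (λ big → none (v , Uv , big))))
    S : Subset n
    S = proj₁ greedy

  outside-N[]-≤ : ∀ U v m c → count U ≡ suc m → c ≤ count (N[ v ]∩ U) → count (U ─N[ v ]) ≤ suc m ∸ c
  outside-N[]-≤ U v m c |U| c≤d = m+n≤o⇒m≤o∸n (count (U ─N[ v ])) (begin
      count (U ─N[ v ]) + c
    ≤⟨ +-monoʳ-≤ (count (U ─N[ v ])) c≤d ⟩
      count (U ─N[ v ]) + count (N[ v ]∩ U)
    ≡⟨ +-comm _ (count (N[ v ]∩ U)) ⟩
      count (N[ v ]∩ U) + count (U ─N[ v ])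
    ≡⟨ trans (sym (count-N[]-split U v)) |U| ⟩
      suc m ∎)
    where open ≤-Reasoning

  ι-bound : ∀ U a → StabilityAtMost U a → ι U ≤ τ (count U) a
  ι-bound = count-induction _ step
    where
    step : ∀ U → (∀ V → count V < count U → ∀ a → StabilityAtMost V a → ι V ≤ τ (count V) a) →
           ∀ a → StabilityAtMost U a → ι U ≤ τ (count U) a
    step U ih a bound with none-or-witness U
    ... | inj₁ empty = subst (_≤ τ (count U) a) (sym (ι-empty U empty)) (τ-pos (count U) a)
    step U ih zero bound | inj₂ (v , Uv) =
      ⊥-elim (1+n≰n (subst (_≤ 0) ∣⁅ v ⁆∣ (bound (∅ [ v ]≔ true) (stableIn-⁅⁆ U v Uv))))
    step U ih (suc b) bound | inj₂ (v , Uv) = bound-at (count-remove-member U v Uv)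
      where
      -- Recurse at a vertex w of high degree and compare with the recurrence of τ.
      bound-at : ∀ {m} → count U ≡ suc m → ι U ≤ τ (count U) (suc b)
      bound-at {m} |U| with high-degree-vertex U m b |U| bound
      ... | w , Uw , big = begin
          ι U
        ≡⟨ ι-recurrence U w Uw ⟩
          ι (U ─ w) + ι (U ─N[ w ])
        ≤⟨ +-mono-≤ (ih (U ─ w) (count-─-< U w Uw) (suc b) (atMost-mono (─⊆ U w) bound))
                    (ih (U ─N[ w ]) (count-─N-< U w Uw) b (atMost-─N Uw bound)) ⟩
          τ (count (U ─ w)) (suc b) + τ (count (U ─N[ w ])) b
        ≤⟨ +-mono-≤ (≤-reflexive (cong (λ x → τ x (suc b)) (count-─-≡ U w |U| Uw)))
                    (τ-mono b (outside-N[]-≤ U w m _ |U| big)) ⟩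
          τ m (suc b) + τ (suc m ∸ suc (m / suc b)) b
        ≡⟨ τ-recurrence m b ⟨
          τ (suc m) (suc b)
        ≡⟨ cong (λ x → τ x (suc b)) |U| ⟨
          τ (count U) (suc b) ∎
        where open ≤-Reasoning

module Transposition (j k : ℕ) where

  swap : ℕ → ℕ
  swap r with r ≟ j | r ≟ k
  ... | yes _ | _ = k
  ... | no _ | yes _ = j
  ... | no _ | no _ = r

  swap-j : swap j ≡ k
  swap-j with j ≟ j
  ... | yes _ = refl
  ... | no j≢j = ⊥-elim (j≢j refl)

  swap-k : swap k ≡ j
  swap-k with k ≟ j | k ≟ k
  ... | yes k≡j | _ = k≡j
  ... | no _ | yes _ = refl
  ... | no _ | no k≢k = ⊥-elim (k≢k refl)

  swap-other : ∀ r → r ≢ j → r ≢ k → swap r ≡ r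
  swap-other r r≢j r≢k with r ≟ j | r ≟ k
  ... | yes r≡j | _ = ⊥-elim (r≢j r≡j)
  ... | no _ | yes r≡k = ⊥-elim (r≢k r≡k)
  ... | no _ | no _ = refl

  swap-cases : ∀ (P : ℕ → ℕ → Set) → P j k → P k j → (∀ r → r ≢ j → r ≢ k → P r r) → ∀ r → P r (swap r)
  swap-cases P Pjk Pkj Prr r = cases (r ≟ j) (r ≟ k)
    where
    cases : Dec (r ≡ j) → Dec (r ≡ k) → P r (swap r)
    cases (yes r≡j) _ = subst (λ x → P x (swap x)) (sym r≡j) (subst (P j) (sym swap-j) Pjk)
    cases (no _) (yes r≡k) = subst (λ x → P x (swap x)) (sym r≡k) (subst (P k) (sym swap-k) Pkj)
    cases (no r≢j) (no r≢k) = subst (P r) (sym (swap-other r r≢j r≢k)) (Prr r r≢j r≢k)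

  swap-involutive : ∀ r → swap (swap r) ≡ r
  swap-involutive = swap-cases (λ r s → swap s ≡ r) swap-k swap-j swap-other

  swap-≡ᵇ : ∀ x r → (swap x ≡ᵇ r) ≡ (x ≡ᵇ swap r)
  swap-≡ᵇ x r = bool-ext _ _
    (λ e → ≡ᵇ-true (trans (sym (swap-involutive x)) (cong swap (≡ᵇ-sound {swap x} e))))
    (λ e → ≡ᵇ-true (trans (cong swap (≡ᵇ-sound {x} e)) (swap-involutive r)))

  swap-≡ᵇ-swap : ∀ x y → (swap x ≡ᵇ swap y) ≡ (x ≡ᵇ y)
  swap-≡ᵇ-swap x y = trans (swap-≡ᵇ x (swap y)) (cong (x ≡ᵇ_) (swap-involutive y))

  swap-< : ∀ {a} x → j < a → k < a → x < a → swap x < a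
  swap-< {a} x j<a k<a x<a = swap-cases (λ r s → r < a → s < a) (λ _ → k<a) (λ _ → j<a) (λ _ _ _ r<a → r<a) x x<a

  swap-<ᵇ : ¬ (j < k) → ∀ r → (swap r <ᵇ k) ≡ (r <ᵇ k)
  swap-<ᵇ j≮k = swap-cases (λ r s → (s <ᵇ k) ≡ (r <ᵇ k))
    (trans (<ᵇ-false (<-irrefl {k} refl)) (sym (<ᵇ-false j≮k)))
    (trans (<ᵇ-false j≮k) (sym (<ᵇ-false (<-irrefl {k} refl))))
    (λ _ _ _ → refl)

module Extremal {n : ℕ} (G : Graph n) where
  open Stability G
  open Clusters G
  open UpperBound G

  -- If the part ι(U ─ N[v]) of the recurrence attains τ(|U| − ⌈|U|/α⌉, α − 1), then N[v] has at most
  -- ⌈|U|/α⌉ vertices: a larger neighbourhood would leave a strictly smaller bound when α ≥ 2.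
  N[]-not-larger : ∀ U m b v → count U ≡ suc m → StabilityAtMost U (suc b) → U v ≡ true →
                   ι (U ─N[ v ]) ≡ τ (suc m ∸ suc (m / suc b)) b → count (N[ v ]∩ U) ≤ suc (m / suc b)
  N[]-not-larger U m zero v |U| _ _ _ = subst (count (N[ v ]∩ U) ≤_) (cong suc (sym (n/1≡n m))) (N[]≤ U v |U|)
  N[]-not-larger U m (suc b) v |U| bound Uv tight with count (N[ v ]∩ U) ≤? suc (m / suc (suc b))
  ... | yes d≤c = d≤c
  ... | no d≰c = ⊥-elim (<-irrefl tight (≤-<-trans (ι-bound (U ─N[ v ]) (suc b) (atMost-─N Uv bound)) (τ-strict-mono b smaller)))
    where
    c : ℕ
    c = suc (m / suc (suc b))
    smaller : count (U ─N[ v ]) < suc m ∸ c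
    smaller = <-≤-trans (s≤s (outside-N[]-≤ U v m (suc c) |U| (≰⇒> d≰c)))
                        (∸-monoʳ-< {suc m} (n<1+n c) (≤-trans (≰⇒> d≰c) (N[]≤ U v |U|)))

  extremal-split : ∀ U m b v → count U ≡ suc m → StabilityAtMost U (suc b) → U v ≡ true →
                   suc (m / suc b) ≤ count (N[ v ]∩ U) → ι U ≡ τ (suc m) (suc b) →
                   ι (U ─ v) ≡ τ m (suc b) × count (N[ v ]∩ U) ≡ suc (m / suc b)
  extremal-split U m b v |U| bound Uv c≤d extremal =
    proj₁ tight , ≤-antisym (N[]-not-larger U m b v |U| bound Uv (proj₂ tight)) c≤d
    where
    -- Both parts of the recurrence are bounded by the parts of τ's recurrence, with equal sums.
    tight : ι (U ─ v) ≡ τ m (suc b) × ι (U ─N[ v ]) ≡ τ (suc m ∸ suc (m / suc b)) b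
    tight = +-tight
      (subst (λ x → ι (U ─ v) ≤ τ x (suc b)) (count-─-≡ U v |U| Uv) (ι-bound (U ─ v) (suc b) (atMost-mono (─⊆ U v) bound)))
      (≤-trans (ι-bound (U ─N[ v ]) b (atMost-─N Uv bound)) (τ-mono b (outside-N[]-≤ U v m _ |U| c≤d)))
      (trans (sym (ι-recurrence U v Uv)) (trans extremal (τ-recurrence m b)))

  NonNeighbourIn : (Fin n → Bool) → Fin n → (Fin n → ℕ) → ℕ → Set
  NonNeighbourIn U v cl r = Σ (Fin n) λ u → (U ─ v) u ≡ true × cl u ≡ r × adj G v u ≡ false

  Transversal : (Fin n → Bool) → Fin n → (Fin n → ℕ) → ℕ → Subset n → Set
  Transversal U v cl k S = StableIn U S × ∣ S ∣ ≡ suc k × (∀ u → lookup S u ≡ true → u ≡ v ⊎ ((U ─ v) u ≡ true × cl u < k))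

  transversal : ∀ U v cl k → U v ≡ true → ClusterOn (U ─ v) cl → (∀ r → r < k → NonNeighbourIn U v cl r) →
                Σ (Subset n) (Transversal U v cl k)
  transversal U v cl zero Uv c pick = ∅ [ v ]≔ true , stableIn-⁅⁆ U v Uv , ∣⁅ v ⁆∣ , only-v
    where
    only-v : ∀ u → lookup (∅ [ v ]≔ true) u ≡ true → u ≡ v ⊎ ((U ─ v) u ≡ true × cl u < 0)
    only-v u e with insert-member ∅ v u e
    ... | inj₁ u≡v = inj₁ u≡v
    ... | inj₂ e′ = ⊥-elim (true≢false e′ (lookup-∅ u))
  transversal U v cl (suc k) Uv c pick with transversal U v cl k Uv c (λ r r<k → pick r (m≤n⇒m≤1+n r<k)) | pick k ≤-refl
  ... | S , st , |S| , members | w , U─v∋w , cw≡k , ¬vw =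
      S [ w ]≔ true , stableIn-insert {U} {S} st (─⊆ U v w U─v∋w) w-free , trans (∣insert∣ S w w∉S) (cong suc |S|) , members′
    where
    w∉S : lookup S w ≡ false
    w∉S with true-or-false (lookup S w)
    ... | inj₂ e = e
    ... | inj₁ e with members w e
    ...   | inj₁ w≡v = ⊥-elim (proj₂ (─-spec U v w U─v∋w) w≡v)
    ...   | inj₂ (_ , cw<k) = ⊥-elim (<-irrefl cw≡k cw<k)
    w-free : ∀ x → lookup S x ≡ true → adj G w x ≡ false
    w-free x e with members x e
    ... | inj₁ refl = trans (adj-sym G w v) ¬vw
    ... | inj₂ (U─v∋x , cx<k) = trans (c w x U─v∋w U─v∋x)
      (trans (cong (not (w == x) ∧_) (≡ᵇ-false (λ cw≡cx → <-irrefl (trans (sym cw≡cx) cw≡k) cx<k))) (∧-zeroʳ _))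
    members′ : ∀ u → lookup (S [ w ]≔ true) u ≡ true → u ≡ v ⊎ ((U ─ v) u ≡ true × cl u < suc k)
    members′ u e with insert-member S w u e
    ... | inj₁ refl = inj₂ (U─v∋w , ≤-reflexive (cong suc cw≡k))
    ... | inj₂ e′ with members u e′
    ...   | inj₁ u≡v = inj₁ u≡v
    ...   | inj₂ (U─v∋u , cu<k) = inj₂ (U─v∋u , m≤n⇒m≤1+n cu<k)

  dominated-class : ∀ U v b cl → U v ≡ true → ClusterOn (U ─ v) cl → StabilityAtMost U (suc b) →
                    Σ ℕ λ j → j < suc b × (∀ u → (U ─ v) u ≡ true → cl u ≡ j → adj G v u ≡ true)
  dominated-class U v b cl Uv c bound with Fin.¬∀⟶∃¬ (suc b) (λ r → NonNeighbourIn U v cl (toℕ r)) nonNeighbour? all-fail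
    where
    nonNeighbour? : ∀ (r : Fin (suc b)) → Dec (NonNeighbourIn U v cl (toℕ r))
    nonNeighbour? r = Fin.any? (λ u → ((U ─ v) u Bool.≟ true) ×-dec ((cl u ≟ toℕ r) ×-dec (adj G v u Bool.≟ false)))
    all-fail : ¬ (∀ (r : Fin (suc b)) → NonNeighbourIn U v cl (toℕ r))
    all-fail every with transversal U v cl (suc b) Uv c (λ r r<a → subst (NonNeighbourIn U v cl) (Fin.toℕ-fromℕ< r<a) (every _))
    ... | S , st , |S| , _ = 1+n≰n (subst (_≤ suc b) |S| (bound S st))
  ... | j , none = toℕ j , Fin.toℕ<n j , dominated
    where
    dominated : ∀ u → (U ─ v) u ≡ true → cl u ≡ toℕ j → adj G v u ≡ true
    dominated u U─v∋u cu≡j with true-or-false (adj G v u)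
    ... | inj₁ vu = vu
    ... | inj₂ ¬vu = ⊥-elim (none (u , U─v∋u , cu≡j , ¬vu))

  N⟨_⟩∩_ : Fin n → (Fin n → Bool) → Fin n → Bool
  (N⟨ v ⟩∩ U) u = (U ─ v) u ∧ adj G v u

  |N[]|≡1+|N⟨⟩| : ∀ U v → U v ≡ true → count (N[ v ]∩ U) ≡ suc (count (N⟨ v ⟩∩ U))
  |N[]|≡1+|N⟨⟩| U v Uv = trans (count-remove-member (N[ v ]∩ U) v (∧-intro Uv (cong (_∨ adj G v v) (==-refl v))))
    (cong suc (count-cong (λ u → reorder (U u) (u == v) (adj G v u))))
    where
    reorder : ∀ a e x → (a ∧ (e ∨ x)) ∧ not e ≡ (a ∧ not e) ∧ x
    reorder false e x = refl
    reorder true true x = refl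
    reorder true false x = ∧-identityʳ x

  neighbourhood-is-class : ∀ U v m b cl j → U v ≡ true → Balanced (U ─ v) m b cl →
    count (N[ v ]∩ U) ≡ suc (m / suc b) → j < suc b → (∀ u → (U ─ v) u ≡ true → cl u ≡ j → adj G v u ≡ true) →
    (∀ u → (U ─ v) u ≡ true → adj G v u ≡ (cl u ≡ᵇ j)) × ¬ (j < m % suc b)
  neighbourhood-is-class U v m b cl j Uv (_ , _ , sizes) |N[v]| j<a dominated = adj≡ , small
    where
    class⊆N : ∀ u → (U ─ v) u ∧ (cl u ≡ᵇ j) ≡ true → (N⟨ v ⟩∩ U) u ≡ true
    class⊆N u e = ∧-intro (∧-elimˡ _ e) (dominated u (∧-elimˡ _ e) (≡ᵇ-sound {cl u} (∧-elimʳ ((U ─ v) u) e)))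
    |N⟨v⟩| : count (N⟨ v ⟩∩ U) ≡ m / suc b
    |N⟨v⟩| = suc-injective (trans (sym (|N[]|≡1+|N⟨⟩| U v Uv)) |N[v]|)
    N≤class : count (N⟨ v ⟩∩ U) ≤ classSize (U ─ v) cl j
    N≤class = subst₂ _≤_ (sym |N⟨v⟩|) (sym (sizes j j<a)) (m≤m+n _ _)
    N⊆class : ∀ u → (N⟨ v ⟩∩ U) u ≡ true → (U ─ v) u ∧ (cl u ≡ᵇ j) ≡ true
    N⊆class = count-⊆-≥⇒⊇ _ _ class⊆N N≤class
    adj≡ : ∀ u → (U ─ v) u ≡ true → adj G v u ≡ (cl u ≡ᵇ j)
    adj≡ u U─v∋u = bool-ext _ _ (λ vu → ∧-elimʳ ((U ─ v) u) (N⊆class u (∧-intro U─v∋u vu)))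
                                (λ e → ∧-elimʳ ((U ─ v) u) (class⊆N u (∧-intro U─v∋u e)))
    small : ¬ (j < m % suc b)
    small j<k = <-irrefl refl (begin-strict
        count (N⟨ v ⟩∩ U)
      ≡⟨ |N⟨v⟩| ⟩
        m / suc b
      <⟨ m<m+n (m / suc b) (≤-reflexive (sym (cong 𝟙 (<ᵇ-true j<k)))) ⟩
        balancedSize m b j
      ≡⟨ sizes j j<a ⟨
        classSize (U ─ v) cl j
      ≤⟨ count-mono _ _ class⊆N ⟩
        count (N⟨ v ⟩∩ U) ∎)
      where open ≤-Reasoning

  -- Adding to a balanced cluster U ─ v of m vertices a vertex v adjacent exactly to a small class j
  -- gives a balanced cluster U of m + 1 vertices: v joins class j, renamed to class k = m mod (b + 1)
  -- (and class k renamed to j).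
  module Extension (U : Fin n → Bool) (v : Fin n) (m b : ℕ) (cl : Fin n → ℕ) (j : ℕ) (Uv : U v ≡ true)
                   (balanced : Balanced (U ─ v) m b cl) (j<a : j < suc b) (j≮k : ¬ (j < m % suc b))
                   (adj≡ : ∀ u → (U ─ v) u ≡ true → adj G v u ≡ (cl u ≡ᵇ j)) where

    c : ClusterOn (U ─ v) cl
    c = proj₁ balanced
    lab : LabelsBelow (U ─ v) cl (suc b)
    lab = proj₁ (proj₂ balanced)
    sizes : ∀ r → r < suc b → classSize (U ─ v) cl r ≡ balancedSize m b r
    sizes = proj₂ (proj₂ balanced)

    k : ℕ
    k = m % suc b
    k<a : k < suc b
    k<a = m%n<n m (suc b)
    open Transposition j k

    cl′ : Fin n → ℕ
    cl′ u = if u == v then k else swap (cl u)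

    cl′-v : cl′ v ≡ k
    cl′-v rewrite ==-refl v = refl

    cl′-other : ∀ u → u ≢ v → cl′ u ≡ swap (cl u)
    cl′-other u u≢v rewrite ==-false u≢v = refl

    adj-v : ∀ w → w ≢ v → U w ≡ true → adj G v w ≡ not (v == w) ∧ (cl′ v ≡ᵇ cl′ w)
    adj-v w w≢v Uw = begin
        adj G v w
      ≡⟨ adj≡ w (─-intro U v w Uw w≢v) ⟩
        (cl w ≡ᵇ j)
      ≡⟨ cong (cl w ≡ᵇ_) (sym swap-k) ⟩
        (cl w ≡ᵇ swap k)
      ≡⟨ sym (swap-≡ᵇ (cl w) k) ⟩
        (swap (cl w) ≡ᵇ k)
      ≡⟨ ≡ᵇ-sym (swap (cl w)) k ⟩
        (k ≡ᵇ swap (cl w))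
      ≡⟨ cong₂ (λ e x → not e ∧ x) (sym (==-false (w≢v ∘ sym))) (cong₂ _≡ᵇ_ (sym cl′-v) (sym (cl′-other w w≢v))) ⟩
        not (v == w) ∧ (cl′ v ≡ᵇ cl′ w) ∎
      where open ≡-Reasoning

    cluster : ClusterOn U cl′
    cluster u w Uu Uw = cases (u Fin.≟ v) (w Fin.≟ v)
      where
      Goal : Fin n → Fin n → Set
      Goal x y = adj G x y ≡ not (x == y) ∧ (cl′ x ≡ᵇ cl′ y)
      cases : Dec (u ≡ v) → Dec (w ≡ v) → Goal u w
      cases (yes u≡v) (yes w≡v) = subst₂ Goal (sym u≡v) (sym w≡v)
        (trans (irrefl G v) (cong (λ e → not e ∧ (cl′ v ≡ᵇ cl′ v)) (sym (==-refl v))))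
      cases (yes u≡v) (no w≢v) = subst (λ x → Goal x w) (sym u≡v) (adj-v w w≢v Uw)
      cases (no u≢v) (yes w≡v) = subst (Goal u) (sym w≡v) (begin
          adj G u v
        ≡⟨ adj-sym G u v ⟩
          adj G v u
        ≡⟨ adj-v u u≢v Uu ⟩
          not (v == u) ∧ (cl′ v ≡ᵇ cl′ u)
        ≡⟨ cong₂ (λ e x → not e ∧ x) (==-sym v u) (≡ᵇ-sym (cl′ v) (cl′ u)) ⟩
          not (u == v) ∧ (cl′ u ≡ᵇ cl′ v) ∎)
        where open ≡-Reasoning
      cases (no u≢v) (no w≢v) = trans (c u w (─-intro U v u Uu u≢v) (─-intro U v w Uw w≢v))
        (cong (not (u == w) ∧_) (trans (sym (swap-≡ᵇ-swap (cl u) (cl w))) (sym (cong₂ _≡ᵇ_ (cl′-other u u≢v) (cl′-other w w≢v)))))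

    labels : LabelsBelow U cl′ (suc b)
    labels u Uu = cases (u Fin.≟ v)
      where
      cases : Dec (u ≡ v) → cl′ u < suc b
      cases (yes u≡v) = subst (λ x → cl′ x < suc b) (sym u≡v) (subst (_< suc b) (sym cl′-v) k<a)
      cases (no u≢v) = subst (_< suc b) (sym (cl′-other u u≢v)) (swap-< (cl u) j<a k<a (lab u (─-intro U v u Uu u≢v)))

    -- Class k gains v and the other classes are permuted among classes of equal size.
    sizes′ : ∀ r → r < suc b → classSize U cl′ r ≡ balancedSize (suc m) b r
    sizes′ r r<a = begin
        classSize U cl′ r
      ≡⟨ classSize-─ U cl′ v r Uv ⟩
        𝟙 (cl′ v ≡ᵇ r) + classSize (U ─ v) cl′ r
      ≡⟨ cong₂ (λ x y → 𝟙 (x ≡ᵇ r) + y) cl′-v (count-cong relabel) ⟩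
        𝟙 (k ≡ᵇ r) + classSize (U ─ v) cl (swap r)
      ≡⟨ cong (𝟙 (k ≡ᵇ r) +_) (sizes (swap r) (swap-< r j<a k<a r<a)) ⟩
        𝟙 (k ≡ᵇ r) + balancedSize m b (swap r)
      ≡⟨ cong (λ x → 𝟙 (k ≡ᵇ r) + (m / suc b + 𝟙 x)) (swap-<ᵇ j≮k r) ⟩
        𝟙 (k ≡ᵇ r) + balancedSize m b r
      ≡⟨ +-comm (𝟙 (k ≡ᵇ r)) _ ⟩
        balancedSize m b r + 𝟙 (k ≡ᵇ r)
      ≡⟨ balancedSize-suc m b r r<a ⟨
        balancedSize (suc m) b r ∎
      where
      open ≡-Reasoning
      relabel : ∀ u → (U ─ v) u ∧ (cl′ u ≡ᵇ r) ≡ (U ─ v) u ∧ (cl u ≡ᵇ swap r)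
      relabel u with (U ─ v) u in U─v∋u
      ... | false = refl
      ... | true = trans (cong (_≡ᵇ r) (cl′-other u (proj₂ (─-spec U v u U─v∋u)))) (swap-≡ᵇ (cl u) r)

  extend-balanced : ∀ U v m b cl j → U v ≡ true → Balanced (U ─ v) m b cl → j < suc b → ¬ (j < m % suc b) →
                    (∀ u → (U ─ v) u ≡ true → adj G v u ≡ (cl u ≡ᵇ j)) → Σ (Fin n → ℕ) (Balanced U (suc m) b)
  extend-balanced U v m b cl j Uv balanced j<a j≮k adj≡ = cl′ , cluster , labels , sizes′
    where open Extension U v m b cl j Uv balanced j<a j≮k adj≡

  extremal-step : ∀ U m b → count U ≡ suc m → StabilityAtMost U (suc b) → ι U ≡ τ (suc m) (suc b) →
    (∀ V → count V ≡ m → StabilityAtMost V (suc b) → ι V ≡ τ m (suc b) → Σ (Fin n → ℕ) (Balanced V m b)) →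
    Σ (Fin n → ℕ) (Balanced U (suc m) b)
  extremal-step U m b |U| bound extremal ih with high-degree-vertex U m b |U| bound
  ... | v , Uv , big with extremal-split U m b v |U| bound Uv big extremal
  ... | ι─v , |N[v]| with ih (U ─ v) (count-─-≡ U v |U| Uv) (atMost-mono (─⊆ U v) bound) ι─v
  ... | cl , balanced with dominated-class U v b cl Uv (proj₁ balanced) bound
  ... | j , j<a , dominated with neighbourhood-is-class U v m b cl j Uv balanced |N[v]| j<a dominated
  ... | adj≡ , small = extend-balanced U v m b cl j Uv balanced j<a small adj≡

  extremal⇒balanced : ∀ b U → StabilityAtMost U (suc b) → ι U ≡ τ (count U) (suc b) →
                      Σ (Fin n → ℕ) (Balanced U (count U) b)
  extremal⇒balanced b = count-induction _ step
    where
    Claim : (Fin n → Bool) → Set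
    Claim U = StabilityAtMost U (suc b) → ι U ≡ τ (count U) (suc b) → Σ (Fin n → ℕ) (Balanced U (count U) b)
    step : ∀ U → (∀ V → count V < count U → Claim V) → Claim U
    step U ih bound extremal with none-or-witness U
    ... | inj₁ empty rewrite count-none U empty =
      (λ _ → 0) , (λ u _ Uu _ → ⊥-elim (true≢false Uu (empty u))) , (λ u Uu → ⊥-elim (true≢false Uu (empty u))) ,
      (λ r _ → count-none _ (λ u → cong (_∧ (0 ≡ᵇ r)) (empty u)))
    ... | inj₂ (v , Uv) = subst (λ x → Σ (Fin n → ℕ) (Balanced U x b)) (sym |U|)
        (extremal-step U m b |U| bound (trans extremal (cong (λ x → τ x (suc b)) |U|)) smaller)
      where
      m : ℕ
      m = count (U ─ v)
      |U| : count U ≡ suc m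
      |U| = count-remove-member U v Uv
      smaller : ∀ V → count V ≡ m → StabilityAtMost V (suc b) → ι V ≡ τ m (suc b) → Σ (Fin n → ℕ) (Balanced V m b)
      smaller V |V| boundV extremalV = subst (λ x → Σ (Fin n → ℕ) (Balanced V x b)) |V|
        (ih V (subst₂ _<_ (sym |V|) (sym |U|) ≤-refl) boundV (trans extremalV (cong (λ x → τ x (suc b)) (sym |V|))))

relabelling : ∀ {n} (c₁ c₂ : Fin n → ℕ) → (∀ r → count (λ i → c₁ i ≡ᵇ r) ≡ count (λ i → c₂ i ≡ᵇ r)) →
              Σ (Permutation′ n) λ φ → ∀ i → c₂ (φ ⟨$⟩ʳ i) ≡ c₁ i
relabelling {zero} c₁ c₂ same = Permutation.id , λ ()
relabelling {suc n} c₁ c₂ same = φ , matches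
  where
  -- Send 0 to some j carrying the same label, and match the remaining elements recursively.
  r₀ : ℕ
  r₀ = c₁ zero
  found : Σ (Fin (suc n)) λ j → (c₂ j ≡ᵇ r₀) ≡ true
  found = count-witness (λ i → c₂ i ≡ᵇ r₀) (subst (1 ≤_) (same r₀) (count-pos (λ i → c₁ i ≡ᵇ r₀) zero (≡ᵇ-refl r₀)))
  j : Fin (suc n)
  j = proj₁ found
  c₂j≡r₀ : c₂ j ≡ r₀
  c₂j≡r₀ = ≡ᵇ-sound {c₂ j} (proj₂ found)
  same-rest : ∀ r → count (λ i → c₁ (suc i) ≡ᵇ r) ≡ count (λ i → c₂ (punchIn j i) ≡ᵇ r)
  same-rest r = +-cancelˡ-≡ (𝟙 (r₀ ≡ᵇ r)) _ _ (trans (same r) (trans (count-punchIn (λ i → c₂ i ≡ᵇ r) j)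
    (cong (λ x → 𝟙 (x ≡ᵇ r) + count (λ i → c₂ (punchIn j i) ≡ᵇ r)) c₂j≡r₀)))
  rest : Σ (Permutation′ n) λ π → ∀ i → c₂ (punchIn j (π ⟨$⟩ʳ i)) ≡ c₁ (suc i)
  rest = relabelling (c₁ ∘ suc) (c₂ ∘ punchIn j) same-rest
  π : Permutation′ n
  π = proj₁ rest
  φ : Permutation′ (suc n)
  φ = insert zero j π
  matches : ∀ i → c₂ (φ ⟨$⟩ʳ i) ≡ c₁ i
  matches zero = c₂j≡r₀
  matches (suc i) = trans (cong c₂ (insert-punchIn zero j π i)) (proj₂ rest i)

==-permute : ∀ {n} (φ : Permutation′ n) i j → ((φ ⟨$⟩ʳ i) == (φ ⟨$⟩ʳ j)) ≡ (i == j)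
==-permute φ i j = bool-ext _ _
  (λ e → subst (λ x → (i == x) ≡ true)
     (trans (sym (inverseˡ φ {i})) (trans (cong (φ ⟨$⟩ˡ_) (==-sound {i = φ ⟨$⟩ʳ i} {φ ⟨$⟩ʳ j} e)) (inverseˡ φ {j}))) (==-refl i))
  (λ e → subst (λ x → ((φ ⟨$⟩ʳ i) == (φ ⟨$⟩ʳ x)) ≡ true) (==-sound {i = i} {j} e) (==-refl (φ ⟨$⟩ʳ i)))

balanced⇒≃ : ∀ {n} (G H : Graph n) m b c₁ c₂ → Clusters.Balanced G full m b c₁ → Clusters.Balanced H full m b c₂ → G ≃G H
balanced⇒≃ {n} G H m b c₁ c₂ (cluster₁ , labels₁ , sizes₁) (cluster₂ , labels₂ , sizes₂) = φ , preserves
  where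
  same-fibres : ∀ r → count (λ i → c₁ i ≡ᵇ r) ≡ count (λ i → c₂ i ≡ᵇ r)
  same-fibres r with r <? suc b
  ... | yes r<a = trans (sizes₁ r r<a) (sym (sizes₂ r r<a))
  ... | no r≮a = trans (count-none _ (λ i → ≡ᵇ-false (λ c₁i≡r → r≮a (subst (_< suc b) c₁i≡r (labels₁ i refl)))))
                      (sym (count-none _ (λ i → ≡ᵇ-false (λ c₂i≡r → r≮a (subst (_< suc b) c₂i≡r (labels₂ i refl))))))
  match : Σ (Permutation′ n) λ φ → ∀ i → c₂ (φ ⟨$⟩ʳ i) ≡ c₁ i
  match = relabelling c₁ c₂ same-fibres
  φ : Permutation′ n
  φ = proj₁ match
  preserves : ∀ i j → adj H (Inverse.to φ i) (Inverse.to φ j) ≡ adj G i j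
  preserves i j = begin
      adj H (φ ⟨$⟩ʳ i) (φ ⟨$⟩ʳ j)
    ≡⟨ cluster₂ _ _ refl refl ⟩
      not ((φ ⟨$⟩ʳ i) == (φ ⟨$⟩ʳ j)) ∧ (c₂ (φ ⟨$⟩ʳ i) ≡ᵇ c₂ (φ ⟨$⟩ʳ j))
    ≡⟨ cong₂ (λ e x → not e ∧ x) (==-permute φ i j) (cong₂ _≡ᵇ_ (proj₂ match i) (proj₂ match j)) ⟩
      not (i == j) ∧ (c₁ i ≡ᵇ c₁ j)
    ≡⟨ sym (cluster₁ i j refl refl) ⟩
      adj G i j ∎
    where open ≡-Reasoning

balanced-transport : ∀ {n} (G H : Graph n) m b c → (iso : G ≃G H) → Clusters.Balanced H full m b c →
                     Clusters.Balanced G full m b (c ∘ Inverse.to (proj₁ iso))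
balanced-transport G H m b c (φ , preserves) (cluster , labels , sizes) = cluster′ , (λ u _ → labels _ refl) , sizes′
  where
  cluster′ : Clusters.ClusterOn G full (c ∘ (φ ⟨$⟩ʳ_))
  cluster′ u w _ _ = trans (sym (preserves u w))
    (trans (cluster _ _ refl refl) (cong (λ e → not e ∧ (c (φ ⟨$⟩ʳ u) ≡ᵇ c (φ ⟨$⟩ʳ w))) (==-permute φ u w)))
  sizes′ : ∀ r → r < suc b → Clusters.classSize G full (c ∘ (φ ⟨$⟩ʳ_)) r ≡ balancedSize m b r
  sizes′ r r<a = trans (count-permute φ (λ i → c i ≡ᵇ r)) (sizes r r<a)

stability-bound : ∀ {n} (G : Graph n) α → HasStabilityNumber G α → Stability.StabilityAtMost G full α
stability-bound G α (_ , maximum) S (_ , st) = maximum S (λ i j i∈S j∈S → st i j ([]=⇒lookup i∈S) ([]=⇒lookup j∈S))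

theorem12 : (n α : ℕ) .{{_ : NonZero α}} (G : Graph n) → HasStabilityNumber G α →
    (F G ≤ fT n α)
    × (fT n α ≡ (⌈ n / α ⌉ + 1) ^ (n % α) * (n / α + 1) ^ (α ∸ n % α))
    × (F G ≡ fT n α ⇔ G ≃G Turan n α)
theorem12 n zero {{()}} G _
theorem12 n (suc b) G hasα = upper-bound , trans (fT≡τ n b) (τ-closed-form n b) , mk⇔ extremal⇒≃Turan ≃Turan⇒extremal
  where
  open Stability G
  T : Graph n
  T = Turan n (suc b)
  α-bound : StabilityAtMost full (suc b)
  α-bound = stability-bound G (suc b) hasα
  τ-full : τ (count {n} full) (suc b) ≡ fT n (suc b)
  τ-full = trans (cong (λ m → τ m (suc b)) (count-all {n})) (sym (fT≡τ n b))
  upper-bound : F G ≤ fT n (suc b)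
  upper-bound = subst₂ _≤_ (sym F≡ι) τ-full (UpperBound.ι-bound G full (suc b) α-bound)
  extremal⇒≃Turan : F G ≡ fT n (suc b) → G ≃G T
  extremal⇒≃Turan extremal with Extremal.extremal⇒balanced G b full α-bound (trans (sym F≡ι) (trans extremal (sym τ-full)))
  ... | cl , balanced = balanced⇒≃ G T n b cl _ (subst (λ m → Clusters.Balanced G full m b cl) (count-all {n}) balanced) (turan-balanced n b)
  ≃Turan⇒extremal : G ≃G T → F G ≡ fT n (suc b)
  ≃Turan⇒extremal iso = trans F≡ι (trans (Clusters.balanced-count G full n b _ (balanced-transport G T n b _ iso (turan-balanced n b)))
                                         (sym (fT≡τ n b)))
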